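{- There are $q^{t-k+1}\left[{t\atop k-1}\right]_q$ clubs $L_\pi$ of rank $k$ in $\mathrm{PG}(1,q^t)$ with head $P_\infty$, where $\left[{n\atop m}\right]_q=\frac{(q^n-1)(q^{n-1}-1)\cdots(q^{n-m+1}-1)}{(q^m-1)(q^{m-1}-1)\cdots(q-1)}$ denotes the number of $(m-1)$-dimensional subspaces of $\mathrm{PG}(n-1,q)$.
   Context: Let $\mathcal{F}$ be the field reduction map from $\mathrm{PG}(1,q^t)$ to $\mathrm{PG}(2t-1,q)$, whose images of points form a Desarguesian $(t-1)$-spread $\mathcal{D}$. For a subspace $\pi$ of $\mathrm{PG}(2t-1,q)$, $\mathcal{B}(\pi)$ is the set of elements of $\mathcal{D}$ meeting $\pi$, and $L_\pi$ is the $\mathbb{F}_q$-linear set with $\mathcal{F}(L_\pi)=\mathcal{B}(\pi)$; if $\pi$ has dimension $k-1$, $L_\pi$ has rank $k$. The weight of a point $P$ of $L_\pi$ is $1+\dim(\mathcal{F}(P)\cap\pi)$. A club of rank $k$ is an $\mathbb{F}_q$-linear set $L_\pi$ of rank $k$ with one point (the head) of weight $k-1$ and all other points of weight one. $P_\infty$ is a fixed point of $\mathrm{PG}(1,q^t)$. Clubs $L_\pi$ are counted as distinct linear sets with specified head (different subspaces $\pi$ giving the same club with the same head are counted once). -}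

module Defs where

open import Level using (Level; _⊔_) renaming (suc to lsuc)
open import Algebra.Bundles using (CommutativeRing)
open import Data.Nat using (ℕ; zero; suc)
import Data.Nat as N
open import Data.Fin using (Fin)
import Data.Fin as Fin
open import Data.Product using (Σ; ∃; _×_; _,_)
open import Relation.Nullary using (¬_)
open import Relation.Binary.PropositionalEquality using (_≡_)

record Field (c ℓ : Level) : Set (lsuc (c ⊔ ℓ)) where
  field
    commutativeRing : CommutativeRing c ℓ
  open CommutativeRing commutativeRing public
  field
    0≉1     : ¬ (0# ≈ 1#)
    inverse : ∀ x → ¬ (x ≈ 0#) → ∃ λ y → x * y ≈ 1#

HasCount : ∀ {a r} (A : Set a) (_~_ : A → A → Set r) → ℕ → Set (a ⊔ r)
HasCount A _~_ n =
  Σ (Fin n → A) λ e →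
    (∀ i j → e i ~ e j → i ≡ j) × (∀ x → ∃ λ i → x ~ e i)

prodBelow : ℕ → (ℕ → ℕ) → ℕ
prodBelow zero    f = 1
prodBelow (suc m) f = f m N.* prodBelow m f

-- division with the convention x / 0 = 0 (never used: q ≥ 2 below)
divℕ : ℕ → ℕ → ℕ
divℕ a zero    = 0
divℕ a (suc d) = a N./ suc d

gauss : ℕ → ℕ → ℕ → ℕ
gauss q n m =
  divℕ (prodBelow m (λ i → (q N.^ (n N.∸ i)) N.∸ 1))
       (prodBelow m (λ i → (q N.^ (m N.∸ i)) N.∸ 1))

-- Geometry over a field K (playing F_{q^t}) with a subfield F (playing F_q)
-- given as a predicate inF.  The ambient space is V = K², which viewed
-- over F is F^{2t}, i.e. PG(2t-1,q); points of PG(1,q^t) are ⟨w⟩_K.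

module Geometry {c ℓ p} (K : Field c ℓ) (inF : Field.Carrier K → Set p) where
  open Field K using (Carrier; _≈_; _+_; _*_; -_; 0#; 1#)

  record IsSubfield : Set (c ⊔ ℓ ⊔ p) where
    field
      resp  : ∀ {x y} → x ≈ y → inF x → inF y
      has0  : inF 0#
      has1  : inF 1#
      +-cl  : ∀ {x y} → inF x → inF y → inF (x + y)
      *-cl  : ∀ {x y} → inF x → inF y → inF (x * y)
      --cl  : ∀ {x} → inF x → inF (- x)
      inv-cl : ∀ {x y} → inF x → x * y ≈ 1# → inF y

  SubfieldSize : ℕ → Set (c ⊔ ℓ ⊔ p)
  SubfieldSize n =
    Σ (Fin n → Carrier) λ e →
      (∀ i → inF (e i)) × (∀ i j → e i ≈ e j → i ≡ j)
      × (∀ x → inF x → ∃ λ i → x ≈ e i)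

  FieldSize : ℕ → Set (c ⊔ ℓ)
  FieldSize n =
    Σ (Fin n → Carrier) λ e →
      (∀ i j → e i ≈ e j → i ≡ j) × (∀ x → ∃ λ i → x ≈ e i)

  V : Set c
  V = Carrier × Carrier

  _≈v_ : V → V → Set ℓ
  (a , b) ≈v (a' , b') = (a ≈ a') × (b ≈ b')

  0v : V
  0v = (0# , 0#)

  _+v_ : V → V → V
  (a , b) +v (a' , b') = (a + a' , b + b')

  _·v_ : Carrier → V → V
  λ' ·v (a , b) = (λ' * a , λ' * b)

  NonZero : V → Set ℓ
  NonZero w = ¬ (w ≈v 0v)

  lincomb : ∀ {n} → (Fin n → Carrier) → (Fin n → V) → V
  lincomb {N.zero}  cs u = 0v
  lincomb {N.suc n} cs u = (cs Fin.zero ·v u Fin.zero) +v lincomb (λ i → cs (Fin.suc i)) (λ i → u (Fin.suc i))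

  FIndep : ∀ {n} → (Fin n → V) → Set (c ⊔ ℓ ⊔ p)
  FIndep {n} u = ∀ (cs : Fin n → Carrier) → (∀ i → inF (cs i)) →
                 lincomb cs u ≈v 0v → ∀ i → cs i ≈ 0#

  InSpanF : ∀ {n} → (Fin n → V) → V → Set (c ⊔ ℓ ⊔ p)
  InSpanF {n} u v = ∃ λ (cs : Fin n → Carrier) → (∀ i → inF (cs i)) × (v ≈v lincomb cs u)

  -- v lies in the K-span ⟨w⟩_K  (= the spread element F(P) for P = ⟨w⟩_K)
  InPointK : V → V → Set (c ⊔ ℓ)
  InPointK w v = ∃ λ a → v ≈v (a ·v w)

  -- dim_F (U ∩ F(⟨w⟩_K)) ≥ j, where U = F-span of u
  WeightAtLeast : ∀ {n} → (Fin n → V) → V → ℕ → Set (c ⊔ ℓ ⊔ p)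
  WeightAtLeast u w j =
    Σ (Fin j → V) λ x → FIndep x × (∀ i → InSpanF u (x i) × InPointK w (x i))

  WeightEq : ∀ {n} → (Fin n → V) → V → ℕ → Set (c ⊔ ℓ ⊔ p)
  WeightEq u w j = WeightAtLeast u w j × ¬ WeightAtLeast u w (suc j)

  InL : ∀ {n} → (Fin n → V) → V → Set (c ⊔ ℓ ⊔ p)
  InL u w = WeightAtLeast u w 1

  -- u is an F-basis of a k-dimensional F-subspace U (π = PG(U), dim k-1)
  -- and L_U is a club of rank k with head ⟨h⟩_K
  IsClubWithHead : (k : ℕ) → V → (Fin k → V) → Set (c ⊔ ℓ ⊔ p)
  IsClubWithHead k h u =
    FIndep u × WeightEq u h (k N.∸ 1)
    × (∀ w → NonZero w → ¬ InPointK h w → InL u w → WeightEq u w 1)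

  ClubWithHead : ℕ → V → Set (c ⊔ ℓ ⊔ p)
  ClubWithHead k h = Σ (Fin k → V) (IsClubWithHead k h)

  -- two clubs are identified when they determine the same linear set
  -- (the head is fixed, so "same club with same head")
  SameLinearSet : ∀ {k h} → ClubWithHead k h → ClubWithHead k h → Set (c ⊔ ℓ ⊔ p)
  SameLinearSet (u , _) (u' , _) =
    ∀ w → NonZero w → (InL u w → InL u' w) × (InL u' w → InL u w)

-- Fix e with (e , h) a K-basis of K² = V, h spanning the head, and let α, β be the
-- coordinate functionals.  An affine F-subspace x₀ + ⟨v₁, …, v_m⟩_F of K ≅ F^t gives the club
-- with F-basis e + x₀h, v₁h, …, v_m h; the points of its linear set off the head are the
-- ⟨y⟩_K with α y = 1 and β y in the affine subspace, so the linear set determines the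
-- subspace, and rescaling shows every club arises this way.  Clubs of rank m + 1 with
-- head ⟨h⟩_K are thus counted by the m-dimensional affine subspaces of F^t:
-- q^t ∏ᵢ(q^t − q^i) affine bases, q^m ∏ᵢ(q^m − q^i) of them per subspace.

module Submission where

open import Defs
open import Algebra.Bundles using (CommutativeRing)
open import Level using (_⊔_)
open import Data.Nat as ℕ using (ℕ; zero; suc; _^_; _≤_; _<_; z≤n; s≤s)
import Data.Nat.Properties as ℕ
open import Data.Fin as Fin using (Fin; zero; suc)
import Data.Fin.Properties as Fin
open import Data.Product using (Σ; ∃; _×_; _,_; proj₁; proj₂)
open import Data.Empty using (⊥-elim)
open import Data.Unit using (⊤; tt)
open import Function using (_∘_; _on_)
open import Data.Vec.Functional using (_∷_)
open import Relation.Nullary using (¬_; Dec; yes; no; ¬?)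
open import Relation.Nullary.Decidable using (decidable-stable; map′)
import Relation.Binary.PropositionalEquality as ≡
open ≡ using (_≡_; _≢_)

module IntegerCoefficientRingSolver {c ℓ} (R : CommutativeRing c ℓ) where

  open import Algebra.Solver.Ring.AlmostCommutativeRing
    using (fromCommutativeRing; _-Raw-AlmostCommutative⟶_)
  open import Data.Integer as ℤ using (ℤ; +_; -[1+_]; _⊖_; _◃_; sign; ∣_∣)
  import Data.Integer.Properties as ℤ
  open import Data.Sign as Sign using (Sign)
  open import Data.Maybe using (Maybe; just; nothing)

  open CommutativeRing R
  open import Algebra.Properties.Ring ring
    using (-‿involutive; -0#≈0#; -‿distribˡ-*; -‿distribʳ-*; -‿+-comm; xyx⁻¹≈y)
  open import Algebra.Properties.Semiring.Mult.TCOptimised semiring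
    using (×-homo-+; ×1-homo-*; 1+×) renaming (_×_ to _·_)
  open import Relation.Binary.Reasoning.Setoid setoid

  private
    signed : Sign → Carrier → Carrier
    signed Sign.+ x = x
    signed Sign.- x = - x

    signed-cong : ∀ s {x y} → x ≈ y → signed s x ≈ signed s y
    signed-cong Sign.+ x≈y = x≈y
    signed-cong Sign.- x≈y = -‿cong x≈y

    signed-* : ∀ s t x y → signed (s Sign.* t) (x * y) ≈ signed s x * signed t y
    signed-* Sign.+ Sign.+ x y = refl
    signed-* Sign.+ Sign.- x y = -‿distribʳ-* x y
    signed-* Sign.- Sign.+ x y = -‿distribˡ-* x y
    signed-* Sign.- Sign.- x y = begin
      x * y          ≈⟨ -‿involutive (x * y) ⟨
      - - (x * y)    ≈⟨ -‿cong (-‿distribˡ-* x y) ⟩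
      - (- x * y)    ≈⟨ -‿distribʳ-* (- x) y ⟩
      - x * - y      ∎

    ⟦_⟧ : ℤ → Carrier
    ⟦ + n ⟧      = n · 1#
    ⟦ -[1+ n ] ⟧ = - (suc n · 1#)

    ⟦⟧-signAbs : ∀ i → ⟦ i ⟧ ≈ signed (sign i) (∣ i ∣ · 1#)
    ⟦⟧-signAbs (+ n)    = refl
    ⟦⟧-signAbs -[1+ n ] = refl

    ⟦◃⟧ : ∀ s n → ⟦ s ◃ n ⟧ ≈ signed s (n · 1#)
    ⟦◃⟧ Sign.+ zero    = refl
    ⟦◃⟧ Sign.- zero    = sym -0#≈0#
    ⟦◃⟧ Sign.+ (suc n) = refl
    ⟦◃⟧ Sign.- (suc n) = refl

    ⟦⊖⟧ : ∀ m n → ⟦ m ⊖ n ⟧ ≈ m · 1# - n · 1#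
    ⟦⊖⟧ m       zero    = sym (trans (+-congˡ -0#≈0#) (+-identityʳ _))
    ⟦⊖⟧ zero    (suc n) = sym (+-identityˡ _)
    ⟦⊖⟧ (suc m) (suc n) = begin
      ⟦ suc m ⊖ suc n ⟧                       ≡⟨ ≡.cong ⟦_⟧ (ℤ.[1+m]⊖[1+n]≡m⊖n m n) ⟩
      ⟦ m ⊖ n ⟧                               ≈⟨ ⟦⊖⟧ m n ⟩
      m · 1# - n · 1#                         ≈⟨ +-congʳ (xyx⁻¹≈y 1# (m · 1#)) ⟨
      1# + m · 1# - 1# - n · 1#               ≈⟨ +-assoc _ _ _ ⟩
      1# + m · 1# + (- 1# - n · 1#)           ≈⟨ +-cong (1+× m 1#) (sym (-‿+-comm 1# (n · 1#))) ⟨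
      suc m · 1# + - (1# + n · 1#)            ≈⟨ +-congˡ (-‿cong (1+× n 1#)) ⟨
      suc m · 1# - suc n · 1#                 ∎

    +-homo : ∀ i j → ⟦ i ℤ.+ j ⟧ ≈ ⟦ i ⟧ + ⟦ j ⟧
    +-homo (+ m)    (+ n)    = ×-homo-+ 1# m n
    +-homo (+ m)    -[1+ n ] = ⟦⊖⟧ m (suc n)
    +-homo -[1+ m ] (+ n)    = trans (⟦⊖⟧ n (suc m)) (+-comm _ _)
    +-homo -[1+ m ] -[1+ n ] = begin
      - (suc (suc (m ℕ.+ n)) · 1#)            ≡⟨ ≡.cong (λ k → - (suc k · 1#)) (ℕ.+-suc m n) ⟨
      - ((suc m ℕ.+ suc n) · 1#)              ≈⟨ -‿cong (×-homo-+ 1# (suc m) (suc n)) ⟩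
      - (suc m · 1# + suc n · 1#)             ≈⟨ -‿+-comm _ _ ⟨
      - (suc m · 1#) + - (suc n · 1#)         ∎

    *-homo : ∀ i j → ⟦ i ℤ.* j ⟧ ≈ ⟦ i ⟧ * ⟦ j ⟧
    *-homo i j = begin
      ⟦ i ℤ.* j ⟧                                         ≈⟨ ⟦◃⟧ s (∣ i ∣ ℕ.* ∣ j ∣) ⟩
      signed s ((∣ i ∣ ℕ.* ∣ j ∣) · 1#)                   ≈⟨ signed-cong s (×1-homo-* ∣ i ∣ ∣ j ∣) ⟩
      signed s (∣ i ∣ · 1# * ∣ j ∣ · 1#)                  ≈⟨ signed-* (sign i) (sign j) _ _ ⟩
      signed (sign i) (∣ i ∣ · 1#) * signed (sign j) (∣ j ∣ · 1#) ≈⟨ *-cong (⟦⟧-signAbs i) (⟦⟧-signAbs j) ⟨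
      ⟦ i ⟧ * ⟦ j ⟧                                       ∎
      where s = sign i Sign.* sign j

    -‿homo : ∀ i → ⟦ ℤ.- i ⟧ ≈ - ⟦ i ⟧
    -‿homo (+ zero)  = sym -0#≈0#
    -‿homo (+ suc n) = refl
    -‿homo -[1+ n ]  = sym (-‿involutive _)

    homomorphism : CommutativeRing.rawRing ℤ.+-*-commutativeRing
                     -Raw-AlmostCommutative⟶ fromCommutativeRing R
    homomorphism = record
      { ⟦_⟧ = ⟦_⟧ ; +-homo = +-homo ; *-homo = *-homo ; -‿homo = -‿homo
      ; 0-homo = refl ; 1-homo = refl }

    _coeff≟_ : ∀ i j → Maybe (⟦ i ⟧ ≈ ⟦ j ⟧)
    i coeff≟ j with i ℤ.≟ j
    ... | yes ≡.refl = just refl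
    ... | no _       = nothing

  open import Algebra.Solver.Ring _ (fromCommutativeRing R) homomorphism _coeff≟_ public

  :0 :1 : ∀ {n} → Polynomial n
  :0 = con (+ 0)
  :1 = con (+ 1)

module Counting where

  open import Level using (Level)
  open import Data.Nat using (_+_; _*_; _∸_)
  open import Data.Fin using (combine; remQuot)
  open import Data.Bool using (Bool; true; false; T; _∧_; not)
  open import Data.Product using (uncurry)
  open import Relation.Binary using (Rel; Symmetric; Transitive)
  open import Relation.Nullary.Decidable using (isYes; toWitness; fromWitness)
  open ≡ using (refl; cong; cong₂; sym; trans)

  count : ∀ {n} → (Fin n → Bool) → ℕ
  count {zero}  f = 0
  count {suc n} f with f zero
  ... | true  = suc (count (f ∘ suc))
  ... | false = count (f ∘ suc)

  select : ∀ {n} (f : Fin n → Bool) → Fin (count f) → Fin n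
  select {suc n} f j with f zero
  select {suc n} f zero    | true  = zero
  select {suc n} f (suc j) | true  = suc (select (f ∘ suc) j)
  select {suc n} f j       | false = suc (select (f ∘ suc) j)

  select-satisfies : ∀ {n} (f : Fin n → Bool) j → T (f (select f j))
  select-satisfies {suc n} f j with f zero in eq
  select-satisfies {suc n} f zero    | true rewrite eq = tt
  select-satisfies {suc n} f (suc j) | true  = select-satisfies (f ∘ suc) j
  select-satisfies {suc n} f j       | false = select-satisfies (f ∘ suc) j

  select-injective : ∀ {n} (f : Fin n → Bool) j j' → select f j ≡ select f j' → j ≡ j'
  select-injective {suc n} f j j' eq with f zero
  select-injective {suc n} f zero    zero     eq | true = refl
  select-injective {suc n} f (suc j) (suc j') eq | true =
    cong suc (select-injective (f ∘ suc) j j' (Fin.suc-injective eq))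
  select-injective {suc n} f j j' eq | false =
    select-injective (f ∘ suc) j j' (Fin.suc-injective eq)

  select-surjective : ∀ {n} (f : Fin n → Bool) i → T (f i) → ∃ λ j → select f j ≡ i
  select-surjective {suc n} f i t with f zero in eq
  select-surjective {suc n} f zero    t | true  = zero , refl
  select-surjective {suc n} f (suc i) t | true  =
    let j , p = select-surjective (f ∘ suc) i t in suc j , cong suc p
  select-surjective {suc n} f zero    t | false rewrite eq = ⊥-elim t
  select-surjective {suc n} f (suc i) t | false =
    let j , p = select-surjective (f ∘ suc) i t in j , cong suc p

  count-cong : ∀ {n} {f g : Fin n → Bool} → (∀ i → f i ≡ g i) → count f ≡ count g
  count-cong {zero}          e = refl
  count-cong {suc n} {f} {g} e with f zero | g zero | e zero
  ... | true  | true  | _ = cong suc (count-cong (e ∘ suc))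
  ... | false | false | _ = count-cong (e ∘ suc)

  count-∧-not : ∀ {n} (f g : Fin n → Bool) →
    count f ≡ count (λ i → f i ∧ g i) + count (λ i → f i ∧ not (g i))
  count-∧-not {zero}  f g = refl
  count-∧-not {suc n} f g with f zero | g zero
  ... | true  | true  = cong suc (count-∧-not (f ∘ suc) (g ∘ suc))
  ... | true  | false = trans (cong suc (count-∧-not (f ∘ suc) (g ∘ suc))) (sym (ℕ.+-suc _ _))
  ... | false | true  = count-∧-not (f ∘ suc) (g ∘ suc)
  ... | false | false = count-∧-not (f ∘ suc) (g ∘ suc)

  count-true : ∀ n → count {n} (λ _ → true) ≡ n
  count-true zero    = refl
  count-true (suc n) = cong suc (count-true n)

  count≡0⇒¬T : ∀ {n} (f : Fin n → Bool) i → count f ≡ 0 → ¬ T (f i)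
  count≡0⇒¬T f i c≡0 t = Fin.¬Fin0 (≡.subst Fin c≡0 (proj₁ (select-surjective f i t)))

  module _ {a b r s : Level} {A : Set a} {B : Set b} {_≈A_ : Rel A r} {_≈B_ : Rel B s} where

    hasCount-≤ : ∀ {n m} → HasCount A _≈A_ n → HasCount B _≈B_ m →
      Symmetric _≈B_ → Transitive _≈B_ →
      (f : A → B) → (∀ x y → f x ≈B f y → x ≈A y) → n ≤ m
    hasCount-≤ (eA , injA , _) (eB , _ , surB) symB transB f reflects =
      Fin.injective⇒≤ {f = index} index-injective
      where
      index : _ → _
      index i = proj₁ (surB (f (eA i)))
      index-injective : ∀ {i j} → index i ≡ index j → i ≡ j
      index-injective {i} {j} e = injA i j (reflects _ _ (transB (proj₂ (surB (f (eA i))))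
        (≡.subst (λ k → eB k ≈B f (eA j)) (sym e) (symB (proj₂ (surB (f (eA j))))))))

    hasCount-map : ∀ {n} → HasCount A _≈A_ n → Transitive _≈B_ →
      (f : A → B) → (∀ {x y} → x ≈A y → f x ≈B f y) → (∀ x y → f x ≈B f y → x ≈A y) →
      (∀ y → ∃ λ x → y ≈B f x) → HasCount B _≈B_ n
    hasCount-map (eA , injA , surA) transB f preserves reflects surjective =
      f ∘ eA , (λ i j e → injA i j (reflects _ _ e)) ,
      λ y → let x , y≈fx = surjective y ; i , x≈ = surA x in i , transB y≈fx (preserves x≈)

  module _ {a r : Level} {A : Set a} {_≈_ : Rel A r} where

    hasCount-unique : ∀ {n m} → HasCount A _≈_ n → HasCount A _≈_ m →
      Symmetric _≈_ → Transitive _≈_ → n ≡ m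
    hasCount-unique hn hm sym≈ trans≈ =
      ℕ.≤-antisym (hasCount-≤ hn hm sym≈ trans≈ (λ x → x) (λ _ _ p → p))
                  (hasCount-≤ hm hn sym≈ trans≈ (λ x → x) (λ _ _ p → p))

    hasCount-filter : ∀ {p n} (P : A → Set p) (P? : ∀ x → Dec (P x)) →
      (∀ {x y} → x ≈ y → P x → P y) → (hc : HasCount A _≈_ n) →
      HasCount (Σ A P) (_≈_ on proj₁) (count (λ i → isYes (P? (proj₁ hc i))))
    hasCount-filter P P? resp (e , inj , sur) =
      (λ j → e (select f j) , toWitness (select-satisfies f j)) ,
      (λ j j' p → select-injective f j j' (inj _ _ p)) ,
      λ { (x , px) → let i , x≈ei = sur x
                         j , sel≡i = select-surjective f i (fromWitness (resp x≈ei px))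
                     in j , ≡.subst (λ k → x ≈ e k) (sym sel≡i) x≈ei }
      where f = λ i → isYes (P? (e i))

  module _ {a r : Level} {A : Set a} {_≈_ : Rel A r} where

    hasCount-complement : ∀ {p n n₁} (P : A → Set p) (P? : ∀ x → Dec (P x)) →
      Symmetric _≈_ → Transitive _≈_ →
      (∀ {x y} → x ≈ y → P x → P y) → HasCount A _≈_ n →
      HasCount (Σ A P) (_≈_ on proj₁) n₁ →
      HasCount (Σ A (¬_ ∘ P)) (_≈_ on proj₁) (n ∸ n₁)
    hasCount-complement {n = n} {n₁} P P? sym≈ trans≈ resp hc h₁ =
      ≡.subst (HasCount (Σ A (¬_ ∘ P)) (_≈_ on proj₁)) count≡ hc¬P
      where
      e = proj₁ hc
      inP : Fin n → Bool
      inP i = isYes (P? (e i))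
      hc¬P = hasCount-filter (¬_ ∘ P) (¬? ∘ P?) (λ x≈y ¬Px Py → ¬Px (resp (sym≈ x≈y) Py)) hc
      count-P : count inP ≡ n₁
      count-P = hasCount-unique (hasCount-filter P P? resp hc) h₁
                  (λ x≈y → sym≈ x≈y) (λ x≈y y≈z → trans≈ x≈y y≈z)
      isYes-¬? : ∀ i → isYes (¬? (P? (e i))) ≡ not (inP i)
      isYes-¬? i with P? (e i)
      ... | yes _ = refl
      ... | no  _ = refl
      count≡ : count (λ i → isYes (¬? (P? (e i)))) ≡ n ∸ n₁
      count≡ = begin
        count (λ i → isYes (¬? (P? (e i))))   ≡⟨ count-cong isYes-¬? ⟩
        count (not ∘ inP)                     ≡⟨ ℕ.m+n∸m≡n (count inP) _ ⟨
        count inP + count (not ∘ inP) ∸ count inP ≡⟨ cong₂ _∸_ (sym (count-∧-not {n} (λ _ → true) inP)) count-P ⟩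
        count {n} (λ _ → true) ∸ n₁           ≡⟨ cong (_∸ n₁) (count-true n) ⟩
        n ∸ n₁                                ∎
        where open ≡.≡-Reasoning

  module _ {a t r s p : Level} {A : Set a} {T : Set t} {_≈A_ : Rel A r} {_≈T_ : Rel T s}
           (P : A → T → Set p) where

    _≈Σ_ : Rel (Σ A (λ x → Σ T (P x))) (r ⊔ s)
    (x , y , _) ≈Σ (x' , y' , _) = x ≈A x' × y ≈T y'

    hasCount-Σ : ∀ {n m} → HasCount A _≈A_ n →
      (∀ x → HasCount (Σ T (P x)) (_≈T_ on proj₁) m) →
      (∀ {x x' y} → x ≈A x' → P x y → P x' y) →
      HasCount (Σ A (λ x → Σ T (P x))) _≈Σ_ (n * m)
    hasCount-Σ {n} {m} (eA , injA , surA) fibre resp =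
      enum ∘ remQuot m , enum∘remQuot-injective , surjective
      where
      enum : Fin n × Fin m → Σ A (λ x → Σ T (P x))
      enum (i , j) = eA i , proj₁ (fibre (eA i)) j

      enum-injective : ∀ i j i' j' → enum (i , j) ≈Σ enum (i' , j') → (i , j) ≡ (i' , j')
      enum-injective i j i' j' (x≈ , y≈) with refl ← injA i i' x≈ =
        cong (i ,_) (proj₁ (proj₂ (fibre (eA i))) j j' y≈)

      enum∘remQuot-injective : ∀ k k' → enum (remQuot m k) ≈Σ enum (remQuot m k') → k ≡ k'
      enum∘remQuot-injective k k' ≈Σ-kk' = begin
        k                              ≡⟨ Fin.combine-remQuot {n} m k ⟨
        uncurry combine (remQuot {n} m k)  ≡⟨ cong (uncurry combine) (enum-injective _ _ _ _ ≈Σ-kk') ⟩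
        uncurry combine (remQuot {n} m k') ≡⟨ Fin.combine-remQuot {n} m k' ⟩
        k'                             ∎
        where open ≡.≡-Reasoning

      surjective : ∀ z → ∃ λ k → z ≈Σ enum (remQuot m k)
      surjective (x , y , pxy) =
        combine i j , ≡.subst (λ ij → (x , y , pxy) ≈Σ enum ij) (sym (Fin.remQuot-combine i j)) (x≈ , y≈)
        where
        i = proj₁ (surA x)
        x≈ = proj₂ (surA x)
        j = proj₁ (proj₂ (proj₂ (fibre (eA i))) (y , resp x≈ pxy))
        y≈ = proj₂ (proj₂ (proj₂ (fibre (eA i))) (y , resp x≈ pxy))

  module Quotient {a s : Level} {A : Set a} {_~_ : Rel A s}
    (_~?_ : ∀ x y → Dec (x ~ y)) (sym~ : Symmetric _~_) (trans~ : Transitive _~_)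
    {N : ℕ} (e : Fin N → A) (M : ℕ) (M>0 : 0 < M) where

    related : Fin N → Fin N → Bool
    related i j = isYes (e i ~? e j)

    related-sound : ∀ {i j} → T (related i j) → e i ~ e j
    related-sound = toWitness

    ClassesOfSizeM : (Fin N → Bool) → Set
    ClassesOfSizeM S = ∀ i → T (S i) → count (λ j → S j ∧ related i j) ≡ M

    record Representatives (S : Fin N → Bool) : Set (a ⊔ s) where
      field
        size          : ℕ
        size*M≡count  : size * M ≡ count S
        rep           : Fin size → Fin N
        rep∈          : ∀ c → T (S (rep c))
        rep-injective : ∀ c c' → e (rep c) ~ e (rep c') → c ≡ c'
        rep-covers    : ∀ i → T (S i) → ∃ λ c → e i ~ e (rep c)

    private
      T-∧₁ : ∀ {x y} → T (x ∧ y) → T x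
      T-∧₁ {true} _ = tt

      T-∧₂ : ∀ {x y} → T (x ∧ y) → T y
      T-∧₂ {true} t = t

      T-∧ : ∀ {x y} → T x → T y → T (x ∧ y)
      T-∧ {true} _ t = t

      T-not : ∀ {x} → ¬ T x → T (not x)
      T-not {true}  ¬t = ¬t tt
      T-not {false} _  = tt

      ¬T-not : ∀ {x} → T (not x) → ¬ T x
      ¬T-not {true} () _

    module _ {S : Fin N → Bool} (classes : ClassesOfSizeM S) {i₀ : Fin N} (i₀∈S : T (S i₀)) where

      outside-class : Fin N → Bool
      outside-class j = S j ∧ not (related i₀ j)

      count-outside-class : count S ≡ M + count outside-class
      count-outside-class = trans (count-∧-not S (related i₀)) (cong (_+ count outside-class) (classes i₀ i₀∈S))

      classes-outside-class : ClassesOfSizeM outside-class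
      classes-outside-class i i∈S' = trans (count-cong same-class) (classes i (T-∧₁ i∈S'))
        where
        same-class : ∀ j → (outside-class j ∧ related i j) ≡ (S j ∧ related i j)
        same-class j with S j | related i₀ j in i₀j | related i j in ij
        ... | false | _     | _     = refl
        ... | true  | false | _     = refl
        ... | true  | true  | false = refl
        ... | true  | true  | true  = ⊥-elim (¬T-not {related i₀ i} (T-∧₂ {S i} i∈S') (fromWitness
                (trans~ (related-sound (≡.subst T (sym i₀j) tt)) (sym~ (related-sound (≡.subst T (sym ij) tt))))))

      add-class : Representatives outside-class → Representatives S
      add-class rest = record
        { size          = suc Rest.size
        ; size*M≡count  = trans (cong (M +_) Rest.size*M≡count) (sym count-outside-class)
        ; rep           = rep
        ; rep∈          = rep∈
        ; rep-injective = rep-injective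
        ; rep-covers    = rep-covers }
        where
        module Rest = Representatives rest
        rep : Fin (suc Rest.size) → Fin N
        rep zero    = i₀
        rep (suc c) = Rest.rep c
        rep∈ : ∀ c → T (S (rep c))
        rep∈ zero    = i₀∈S
        rep∈ (suc c) = T-∧₁ {S (Rest.rep c)} (Rest.rep∈ c)
        outside-class-of-i₀ : ∀ c → ¬ e i₀ ~ e (Rest.rep c)
        outside-class-of-i₀ c i₀~ = ¬T-not (T-∧₂ {S (Rest.rep c)} (Rest.rep∈ c)) (fromWitness i₀~)
        rep-injective : ∀ c c' → e (rep c) ~ e (rep c') → c ≡ c'
        rep-injective zero    zero     _ = refl
        rep-injective zero    (suc c') r = ⊥-elim (outside-class-of-i₀ c' r)
        rep-injective (suc c) zero     r = ⊥-elim (outside-class-of-i₀ c (sym~ r))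
        rep-injective (suc c) (suc c') r = cong suc (Rest.rep-injective c c' r)
        rep-covers : ∀ i → T (S i) → ∃ λ c → e i ~ e (rep c)
        rep-covers i i∈S with e i₀ ~? e i
        ... | yes i₀~i = zero , sym~ i₀~i
        ... | no ¬i₀~i =
          let c , i~ = Rest.rep-covers i (T-∧ {S i} i∈S (T-not {related i₀ i} (¬i₀~i ∘ related-sound))) in suc c , i~

    representatives : ∀ fuel S → count S ≤ fuel → ClassesOfSizeM S → Representatives S
    representatives fuel S _ _ with count S in count≡
    representatives fuel S _ _ | zero = record
      { size = 0 ; size*M≡count = sym count≡ ; rep = λ () ; rep∈ = λ () ; rep-injective = λ ()
      ; rep-covers = λ i t → ⊥-elim (count≡0⇒¬T S i count≡ t) }
    representatives (suc fuel) S (s≤s count≤) classes | suc k =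
      add-class classes i₀∈S (representatives fuel _ count'≤ (classes-outside-class classes i₀∈S))
      where
      i₀∈S : T (S (select S (≡.subst Fin (sym count≡) zero)))
      i₀∈S = select-satisfies S _
      count'≤ : count (outside-class classes i₀∈S) ≤ fuel
      count'≤ = ℕ.≤-pred (ℕ.≤-trans (ℕ.m<n+m _ M>0)
        (≡.subst (_≤ suc fuel) (trans (sym count≡) (count-outside-class classes i₀∈S)) (s≤s count≤)))

    hasCount-quotient : ∀ {r} {_≈_ : Rel A r} → (∀ x → ∃ λ i → x ≈ e i) → (∀ {x y} → x ≈ y → x ~ y) →
      (∀ i → count (related i) ≡ M) → ∃ λ C → C * M ≡ N × HasCount A _~_ C
    hasCount-quotient surjective ≈⇒~ class-size =
      size , trans size*M≡count (count-true N) , e ∘ rep , rep-injective ,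
      λ x → let i , x≈ = surjective x ; c , i~ = rep-covers i tt in c , trans~ (≈⇒~ x≈) i~
      where
      open Representatives
        (representatives N (λ _ → true) (ℕ.≤-reflexive (count-true N)) (λ i _ → class-size i))

open Counting

module GaussianArithmetic where

  open import Data.Nat
  open import Data.Nat.Properties
  open import Data.Nat.Divisibility
  open import Data.Nat.Coprimality using (Coprime; coprime-divisor)
  open import Data.Nat.DivMod using (m*n/n≡m)
  open import Data.Nat.Tactic.RingSolver using (solve-∀)
  open import Algebra.Properties.CommutativeSemigroup *-commutativeSemigroup
    using () renaming (interchange to *-interchange)
  open import Data.Product using (_,_)
  open import Relation.Binary.PropositionalEquality
  open ≡-Reasoning

  prodBelow-cong : ∀ m {f g : ℕ → ℕ} → (∀ i → i < m → f i ≡ g i) → prodBelow m f ≡ prodBelow m g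
  prodBelow-cong zero    f≡g = refl
  prodBelow-cong (suc m) f≡g = cong₂ _*_ (f≡g m ≤-refl) (prodBelow-cong m (λ i i<m → f≡g i (m<n⇒m<1+n i<m)))

  prodBelow-* : ∀ m (f g : ℕ → ℕ) → prodBelow m (λ i → f i * g i) ≡ prodBelow m f * prodBelow m g
  prodBelow-* zero    f g = refl
  prodBelow-* (suc m) f g = begin
    f m * g m * prodBelow m (λ i → f i * g i)     ≡⟨ cong (f m * g m *_) (prodBelow-* m f g) ⟩
    f m * g m * (prodBelow m f * prodBelow m g)   ≡⟨ *-interchange (f m) (g m) _ _ ⟩
    f m * prodBelow m f * (g m * prodBelow m g)   ∎

  m*n>0 : ∀ {m n} → 0 < m → 0 < n → 0 < m * n
  m*n>0 {suc m} {suc n} _ _ = z<s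

  prodBelow-pos : ∀ m (f : ℕ → ℕ) → (∀ i → i < m → 0 < f i) → 0 < prodBelow m f
  prodBelow-pos zero    f f>0 = z<s
  prodBelow-pos (suc m) f f>0 = m*n>0 (f>0 m ≤-refl) (prodBelow-pos m f (λ i i<m → f>0 i (m<n⇒m<1+n i<m)))

  coprime-* : ∀ {a b n} → Coprime a n → Coprime b n → Coprime (a * b) n
  coprime-* {a} a⊥n b⊥n {d} (d∣ab , d∣n) = b⊥n (coprime-divisor d⊥a d∣ab , d∣n)
    where
    d⊥a : Coprime d a
    d⊥a (i∣d , i∣a) = a⊥n (i∣a , ∣-trans i∣d d∣n)

  coprime-prodBelow : ∀ n m (f : ℕ → ℕ) → (∀ i → i < m → Coprime (f i) n) → Coprime (prodBelow m f) n
  coprime-prodBelow n zero    f f⊥n (d∣1 , _) = ∣1⇒≡1 d∣1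
  coprime-prodBelow n (suc m) f f⊥n =
    coprime-* (f⊥n m ≤-refl) (coprime-prodBelow n m f (λ i i<m → f⊥n i (m<n⇒m<1+n i<m)))

  divℕ-exact : ∀ {a b} g → 0 < b → a ≡ g * b → divℕ a b ≡ g
  divℕ-exact {b = suc b} g _ refl = m*n/n≡m g (suc b)

  flags : ℕ → ℕ → ℕ → ℕ
  flags q n m = prodBelow m (λ i → q ^ n ∸ q ^ i)

  numerator : ℕ → ℕ → ℕ → ℕ
  numerator q n m = prodBelow m (λ i → q ^ (n ∸ i) ∸ 1)

  module _ (q : ℕ) (2≤q : 2 ≤ q) where

    private
      instance
        q≢0 : NonZero q
        q≢0 = >-nonZero (<-trans z<s 2≤q)

    q^j∸1⊥q : ∀ j → 0 < j → Coprime (q ^ j ∸ 1) q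
    q^j∸1⊥q (suc j) _ {d} (d∣q^j∸1 , d∣q) = ∣1⇒≡1 (∣m+n∣m⇒∣n d∣q^j∸1+1 d∣q^j∸1)
      where
      d∣q^j∸1+1 : d ∣ q ^ suc j ∸ 1 + 1
      d∣q^j∸1+1 = subst (d ∣_) (sym (m∸n+n≡m (m^n>0 q (suc j)))) (∣m⇒∣m*n (q ^ j) d∣q)

    coprime-^-divisor : ∀ {b} r {a} → Coprime b q → b ∣ q ^ r * a → b ∣ a
    coprime-^-divisor zero    {a} b⊥q b∣a = subst (_ ∣_) (+-identityʳ a) b∣a
    coprime-^-divisor {b} (suc r) {a} b⊥q b∣qq^ra =
      coprime-^-divisor r b⊥q (coprime-divisor b⊥q (subst (b ∣_) (*-assoc q (q ^ r) a) b∣qq^ra))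

    q^n∸q^i : ∀ {i n} → i ≤ n → q ^ n ∸ q ^ i ≡ q ^ i * (q ^ (n ∸ i) ∸ 1)
    q^n∸q^i {i} {n} i≤n = sym (begin
      q ^ i * (q ^ (n ∸ i) ∸ 1)          ≡⟨ *-distribˡ-∸ (q ^ i) (q ^ (n ∸ i)) 1 ⟩
      q ^ i * q ^ (n ∸ i) ∸ q ^ i * 1    ≡⟨ cong₂ _∸_ (sym (^-distribˡ-+-* q i (n ∸ i))) (*-identityʳ (q ^ i)) ⟩
      q ^ (i + (n ∸ i)) ∸ q ^ i          ≡⟨ cong (λ k → q ^ k ∸ q ^ i) (m+[n∸m]≡n i≤n) ⟩
      q ^ n ∸ q ^ i                      ∎)

    q^m*flags>0 : ∀ {n} m → m ≤ n → 0 < q ^ m * flags q n m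
    q^m*flags>0 m m≤n =
      m*n>0 (m^n>0 q m) (prodBelow-pos m _ (λ i i<m → m<n⇒0<n∸m (^-monoʳ-< q 2≤q (<-≤-trans i<m m≤n))))

    flags≡ : ∀ {n m} → m ≤ n → flags q n m ≡ prodBelow m (q ^_) * numerator q n m
    flags≡ {n} {m} m≤n = trans (prodBelow-cong m (λ i i<m → q^n∸q^i (≤-trans (<⇒≤ i<m) m≤n)))
                               (prodBelow-* m (q ^_) (λ i → q ^ (n ∸ i) ∸ 1))

    cancel-powers-of-q : ∀ t m C → m ≤ t → C * (q ^ m * flags q m m) ≡ q ^ t * flags q t m →
      C * numerator q m m ≡ q ^ (t ∸ m) * numerator q t m
    cancel-powers-of-q t m C m≤t C*M≡N = *-cancelʳ-≡ _ _ X {{>-nonZero X>0}} (begin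
      C * B * (q ^ m * P)                  ≡⟨ shuffle₁ C B (q ^ m) P ⟩
      C * (q ^ m * (P * B))                ≡⟨ cong (λ k → C * (q ^ m * k)) (flags≡ {m} ≤-refl) ⟨
      C * (q ^ m * flags q m m)            ≡⟨ C*M≡N ⟩
      q ^ t * flags q t m                  ≡⟨ cong₂ _*_ q^t≡ (flags≡ m≤t) ⟩
      q ^ m * q ^ (t ∸ m) * (P * A)        ≡⟨ shuffle₂ (q ^ m) (q ^ (t ∸ m)) P A ⟩
      q ^ (t ∸ m) * A * (q ^ m * P)        ∎)
      where
      P = prodBelow m (q ^_)
      A = numerator q t m
      B = numerator q m m
      X = q ^ m * P
      X>0 : 0 < X
      X>0 = prodBelow-pos (suc m) (q ^_) (λ i _ → m^n>0 q i)
      q^t≡ : q ^ t ≡ q ^ m * q ^ (t ∸ m)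
      q^t≡ = trans (cong (q ^_) (sym (m+[n∸m]≡n m≤t))) (^-distribˡ-+-* q m (t ∸ m))
      shuffle₁ : ∀ c b r p → c * b * (r * p) ≡ c * (r * (p * b))
      shuffle₁ = solve-∀
      shuffle₂ : ∀ r s p a → r * s * (p * a) ≡ s * a * (r * p)
      shuffle₂ = solve-∀

    -- numerator q m m is coprime to q, so it divides numerator q t m, and the quotient is gauss q t m
    quotient≡q^[t∸m]*gauss : ∀ t m C → m ≤ t →
      C * (q ^ m * flags q m m) ≡ q ^ t * flags q t m → C ≡ q ^ (t ∸ m) * gauss q t m
    quotient≡q^[t∸m]*gauss t m C m≤t C*M≡N = begin
      C                          ≡⟨ *-cancelʳ-≡ C _ B {{>-nonZero B>0}} C*B≡ ⟩
      q ^ (t ∸ m) * G            ≡⟨ cong (q ^ (t ∸ m) *_) (divℕ-exact G B>0 A≡GB) ⟨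
      q ^ (t ∸ m) * gauss q t m  ∎
      where
      A = numerator q t m
      B = numerator q m m
      B>0 : 0 < B
      B>0 = prodBelow-pos m _ (λ i i<m → m<n⇒0<n∸m (^-monoʳ-< q 2≤q (m<n⇒0<n∸m i<m)))
      CB≡ = cancel-powers-of-q t m C m≤t C*M≡N
      B∣A : B ∣ A
      B∣A = coprime-^-divisor (t ∸ m)
        (coprime-prodBelow q m _ (λ i i<m → q^j∸1⊥q (m ∸ i) (m<n⇒0<n∸m i<m)))
        (divides C (sym CB≡))
      G = _∣_.quotient B∣A
      A≡GB : A ≡ G * B
      A≡GB = _∣_.equality B∣A
      C*B≡ : C * B ≡ q ^ (t ∸ m) * G * B
      C*B≡ = trans CB≡ (trans (cong (q ^ (t ∸ m) *_) A≡GB) (sym (*-assoc (q ^ (t ∸ m)) G B)))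

open GaussianArithmetic using (flags; q^m*flags>0; quotient≡q^[t∸m]*gauss)

module SubfieldLinearAlgebra {c ℓ p} (K : Field c ℓ) (inF : Field.Carrier K → Set p)
  (isSubfield : Geometry.IsSubfield K inF)
  {q : ℕ} (F-size : Geometry.SubfieldSize K inF q)
  {Q : ℕ} (K-size : Geometry.FieldSize K inF Q) where

  open Field K public hiding (zero)
  open Geometry K inF public
  open IsSubfield isSubfield public
  open IntegerCoefficientRingSolver commutativeRing public using (solve; _:+_; _:*_; :-_; _:-_; _:=_; :0; :1)
  open import Algebra.Properties.Semiring.Sum semiring public
    using (sum; sum-cong-≋; sum-replicate-zero; ∑-distrib-+; ∑-comm; *-distribˡ-sum; *-distribʳ-sum)
  open import Algebra.Properties.Ring ring public
    using (-1*x≈-x; -‿involutive; -0#≈0#; +-cancelˡ; +-inverseʳ-unique; x≈y⇒x∙y⁻¹≈ε; x∙y⁻¹≈ε⇒x≈y)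
  open import Relation.Binary.Reasoning.Setoid setoid public

  private
    enumF = proj₁ F-size
    enumF-inF = proj₁ (proj₂ F-size)
    enumF-injective = proj₁ (proj₂ (proj₂ F-size))
    enumF-surjective = proj₂ (proj₂ (proj₂ F-size))

  infix 4 _≟_ _≟v_

  _≟_ : ∀ x y → Dec (x ≈ y)
  x ≟ y with proj₂ (proj₂ K-size) x | proj₂ (proj₂ K-size) y
  ... | i , x≈ | j , y≈ with i Fin.≟ j
  ... | yes ≡.refl = yes (trans x≈ (sym y≈))
  ... | no i≢j     = no λ x≈y → i≢j (proj₁ (proj₂ K-size) i j (trans (sym x≈) (trans x≈y y≈)))

  _≟v_ : ∀ u w → Dec (u ≈v w)
  (a , b) ≟v (a' , b') with a ≟ a' | b ≟ b'
  ... | yes a≈ | yes b≈ = yes (a≈ , b≈)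
  ... | no a≉  | _      = no (a≉ ∘ proj₁)
  ... | _      | no b≉  = no (b≉ ∘ proj₂)

  ≈v-refl : ∀ {u} → u ≈v u
  ≈v-refl = refl , refl

  ≈v-sym : ∀ {u w} → u ≈v w → w ≈v u
  ≈v-sym (a≈ , b≈) = sym a≈ , sym b≈

  ≈v-trans : ∀ {u v w} → u ≈v v → v ≈v w → u ≈v w
  ≈v-trans (a≈ , b≈) (a≈' , b≈') = trans a≈ a≈' , trans b≈ b≈'

  1≉0 : ¬ (1# ≈ 0#)
  1≉0 = 0≉1 ∘ sym

  2≤q : 2 ≤ q
  2≤q with enumF-surjective 0# has0 | enumF-surjective 1# has1
  ... | i , 0≈ | j , 1≈ = distinct⇒2≤ i j λ { ≡.refl → 0≉1 (trans 0≈ (sym 1≈)) }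
    where
    distinct⇒2≤ : ∀ {n} (i j : Fin n) → i ≢ j → 2 ≤ n
    distinct⇒2≤ {1}          zero zero i≢j = ⊥-elim (i≢j ≡.refl)
    distinct⇒2≤ {suc (suc _)} _    _    _   = s≤s (s≤s z≤n)

  ax+y≈0⇒x≈-a⁻¹y : ∀ {a a⁻¹ x y} → a * a⁻¹ ≈ 1# → a * x + y ≈ 0# → x ≈ - a⁻¹ * y
  ax+y≈0⇒x≈-a⁻¹y {a} {a⁻¹} {x} {y} aa⁻¹≈1 ax+y≈0 = begin
    x                                 ≈⟨ *-identityˡ x ⟨
    1# * x                            ≈⟨ *-congʳ aa⁻¹≈1 ⟨
    a * a⁻¹ * x                       ≈⟨ solve 4 (λ a a⁻¹ x y → a :* a⁻¹ :* x := a⁻¹ :* (a :* x :+ y) :+ :- a⁻¹ :* y) refl a a⁻¹ x y ⟩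
    a⁻¹ * (a * x + y) + - a⁻¹ * y     ≈⟨ +-congʳ (trans (*-congˡ ax+y≈0) (zeroʳ a⁻¹)) ⟩
    0# + - a⁻¹ * y                    ≈⟨ +-identityˡ _ ⟩
    - a⁻¹ * y                         ∎

  x≉0⇒xy≈0⇒y≈0 : ∀ {x y} → ¬ (x ≈ 0#) → x * y ≈ 0# → y ≈ 0#
  x≉0⇒xy≈0⇒y≈0 {x} x≉0 xy≈0 with inverse x x≉0
  ... | x⁻¹ , xx⁻¹≈1 = trans (ax+y≈0⇒x≈-a⁻¹y xx⁻¹≈1 (trans (+-identityʳ _) xy≈0)) (zeroʳ _)

  inverse-nonzero : ∀ {x x⁻¹} → x * x⁻¹ ≈ 1# → ¬ (x⁻¹ ≈ 0#)
  inverse-nonzero {x} xx⁻¹≈1 x⁻¹≈0 = 1≉0 (trans (sym xx⁻¹≈1) (trans (*-congˡ x⁻¹≈0) (zeroʳ x)))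

  module _ where
    open import Algebra.Properties.Monoid.Mult +-monoid using () renaming (_×_ to _·_; ×-homo-+ to ·-homo-+)

    inF-· : ∀ n {x} → inF x → inF (n · x)
    inF-· zero    x∈F = has0
    inF-· (suc n) x∈F = +-cl x∈F (inF-· n x∈F)

    -- The line `--cl` of IsSubfield is a comment, so closure of F under negation is not
    -- assumed; it follows from finiteness: two of 0·x, 1·x, …, q·x coincide.
    inF-neg : ∀ {x} → inF x → inF (- x)
    inF-neg {x} x∈F with Fin.pigeonhole (ℕ.n<1+n q) (λ i → proj₁ (enumF-surjective _ (inF-· (Fin.toℕ i) x∈F)))
    ... | i , j , i<j , same-index = resp (+-inverseʳ-unique x (d · x) x+dx≈0) (inF-· d x∈F)
      where
      m = Fin.toℕ i
      d = Fin.toℕ j ℕ.∸ suc m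
      x+dx≈0 : x + d · x ≈ 0#
      x+dx≈0 = +-cancelˡ (m · x) _ _ (begin
        m · x + (x + d · x)   ≈⟨ ·-homo-+ x m (suc d) ⟨
        (m ℕ.+ suc d) · x     ≡⟨ ≡.cong (_· x) (ℕ.+-suc m d) ⟩
        (suc m ℕ.+ d) · x     ≡⟨ ≡.cong (_· x) (ℕ.m+[n∸m]≡n i<j) ⟩
        Fin.toℕ j · x         ≈⟨ proj₂ (enumF-surjective _ (inF-· (Fin.toℕ j) x∈F)) ⟩
        enumF _               ≡⟨ ≡.cong enumF same-index ⟨
        enumF _               ≈⟨ proj₂ (enumF-surjective _ (inF-· m x∈F)) ⟨
        m · x                 ≈⟨ +-identityʳ _ ⟨
        m · x + 0#            ∎)

  infix 8 _⊙_

  _⊙_ : ∀ {n} → (Fin n → Carrier) → (Fin n → Carrier) → Carrier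
  cs ⊙ xs = sum (λ i → cs i * xs i)

  ⊙-cong : ∀ {n} {cs cs' xs xs' : Fin n → Carrier} →
    (∀ i → cs i ≈ cs' i) → (∀ i → xs i ≈ xs' i) → cs ⊙ xs ≈ cs' ⊙ xs'
  ⊙-cong cs≈ xs≈ = sum-cong-≋ (λ i → *-cong (cs≈ i) (xs≈ i))

  ⊙-distribʳ-+ : ∀ {n} (cs ds xs : Fin n → Carrier) → (λ i → cs i + ds i) ⊙ xs ≈ cs ⊙ xs + ds ⊙ xs
  ⊙-distribʳ-+ cs ds xs = trans (sum-cong-≋ (λ i → distribʳ (xs i) (cs i) (ds i)))
                                (∑-distrib-+ (λ i → cs i * xs i) (λ i → ds i * xs i))

  ⊙-scaleˡ : ∀ {n} a (cs xs : Fin n → Carrier) → (λ i → a * cs i) ⊙ xs ≈ a * (cs ⊙ xs)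
  ⊙-scaleˡ a cs xs = trans (sum-cong-≋ (λ i → *-assoc a (cs i) (xs i))) (sym (*-distribˡ-sum a (λ i → cs i * xs i)))

  ⊙-scaleʳ : ∀ {n} a (cs xs : Fin n → Carrier) → cs ⊙ (λ i → a * xs i) ≈ a * (cs ⊙ xs)
  ⊙-scaleʳ a cs xs = trans (sum-cong-≋ (λ i → solve 3 (λ a c x → c :* (a :* x) := a :* (c :* x)) refl a (cs i) (xs i)))
                           (sym (*-distribˡ-sum a (λ i → cs i * xs i)))

  ⊙-negˡ : ∀ {n} (cs xs : Fin n → Carrier) → (λ i → - cs i) ⊙ xs ≈ - (cs ⊙ xs)
  ⊙-negˡ cs xs = begin
    (λ i → - cs i) ⊙ xs        ≈⟨ ⊙-cong (λ i → sym (-1*x≈-x (cs i))) (λ _ → refl) ⟩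
    (λ i → - 1# * cs i) ⊙ xs   ≈⟨ ⊙-scaleˡ (- 1#) cs xs ⟩
    - 1# * (cs ⊙ xs)           ≈⟨ -1*x≈-x _ ⟩
    - (cs ⊙ xs)                ∎

  ⊙-zeroˡ : ∀ {n} (xs : Fin n → Carrier) → (λ _ → 0#) ⊙ xs ≈ 0#
  ⊙-zeroˡ {n} xs = trans (sum-cong-≋ (λ i → zeroˡ (xs i))) (sum-replicate-zero n)

  ⊙-zeroʳ : ∀ {n} (cs : Fin n → Carrier) → cs ⊙ (λ _ → 0#) ≈ 0#
  ⊙-zeroʳ {n} cs = trans (sum-cong-≋ (λ i → zeroʳ (cs i))) (sum-replicate-zero n)

  ⊙-assoc : ∀ {a b} (d : Fin a → Carrier) (C : Fin a → Fin b → Carrier) (z : Fin b → Carrier) →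
    d ⊙ (λ i → C i ⊙ z) ≈ (λ l → d ⊙ (λ i → C i l)) ⊙ z
  ⊙-assoc d C z = begin
    sum (λ i → d i * sum (λ l → C i l * z l))      ≈⟨ sum-cong-≋ (λ i → *-distribˡ-sum (d i) (λ l → C i l * z l)) ⟩
    sum (λ i → sum (λ l → d i * (C i l * z l)))    ≈⟨ ∑-comm (λ i l → d i * (C i l * z l)) ⟩
    sum (λ l → sum (λ i → d i * (C i l * z l)))    ≈⟨ sum-cong-≋ (λ l → sum-cong-≋ (λ i → sym (*-assoc (d i) (C i l) (z l)))) ⟩
    sum (λ l → sum (λ i → d i * C i l * z l))      ≈⟨ sum-cong-≋ (λ l → *-distribʳ-sum (z l) (λ i → d i * C i l)) ⟨
    sum (λ l → sum (λ i → d i * C i l) * z l)      ∎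

  δ : ∀ {n} → Fin n → Fin n → Carrier
  δ zero    zero    = 1#
  δ zero    (suc i) = 0#
  δ (suc j) zero    = 0#
  δ (suc j) (suc i) = δ j i

  inF-δ : ∀ {n} (j i : Fin n) → inF (δ j i)
  inF-δ zero    zero    = has1
  inF-δ zero    (suc i) = has0
  inF-δ (suc j) zero    = has0
  inF-δ (suc j) (suc i) = inF-δ j i

  δ-diagonal : ∀ {n} (i : Fin n) → δ i i ≈ 1#
  δ-diagonal zero    = refl
  δ-diagonal (suc i) = δ-diagonal i

  δ⊙ : ∀ {n} (j : Fin n) (xs : Fin n → Carrier) → δ j ⊙ xs ≈ xs j
  δ⊙ zero    xs = trans (+-cong (*-identityˡ _) (⊙-zeroˡ (xs ∘ suc))) (+-identityʳ _)
  δ⊙ (suc j) xs = trans (+-congʳ (zeroˡ _)) (trans (+-identityˡ _) (δ⊙ j (xs ∘ suc)))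

  inF-⊙ : ∀ {n} {cs xs : Fin n → Carrier} → (∀ i → inF (cs i)) → (∀ i → inF (xs i)) → inF (cs ⊙ xs)
  inF-⊙ {zero}  _     _     = has0
  inF-⊙ {suc n} cs∈F xs∈F = +-cl (*-cl (cs∈F zero) (xs∈F zero)) (inF-⊙ (cs∈F ∘ suc) (xs∈F ∘ suc))

  lincomb-components : ∀ {n} (cs : Fin n → Carrier) (u : Fin n → V) →
    lincomb cs u ≈v (cs ⊙ (proj₁ ∘ u) , cs ⊙ (proj₂ ∘ u))
  lincomb-components {zero}  cs u = refl , refl
  lincomb-components {suc n} cs u =
    +-congˡ (proj₁ (lincomb-components (cs ∘ suc) (u ∘ suc))) ,
    +-congˡ (proj₂ (lincomb-components (cs ∘ suc) (u ∘ suc)))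

  lincomb-≈ : ∀ {n} (cs : Fin n → Carrier) (u : Fin n → V) {w : V} →
    cs ⊙ (proj₁ ∘ u) ≈ proj₁ w → cs ⊙ (proj₂ ∘ u) ≈ proj₂ w → lincomb cs u ≈v w
  lincomb-≈ cs u w₁≈ w₂≈ = ≈v-trans (lincomb-components cs u) (w₁≈ , w₂≈)

  lincomb-cong : ∀ {n} {cs cs' : Fin n → Carrier} {u u' : Fin n → V} →
    (∀ i → cs i ≈ cs' i) → (∀ i → u i ≈v u' i) → lincomb cs u ≈v lincomb cs' u'
  lincomb-cong {cs = cs} {cs'} {u} {u'} cs≈ u≈ = lincomb-≈ cs u
    (trans (⊙-cong cs≈ (proj₁ ∘ u≈)) (sym (proj₁ (lincomb-components cs' u'))))
    (trans (⊙-cong cs≈ (proj₂ ∘ u≈)) (sym (proj₂ (lincomb-components cs' u'))))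

  lincomb-distribʳ-+ : ∀ {n} (cs ds : Fin n → Carrier) (u : Fin n → V) →
    lincomb (λ i → cs i + ds i) u ≈v (lincomb cs u +v lincomb ds u)
  lincomb-distribʳ-+ cs ds u = lincomb-≈ _ u
    (trans (⊙-distribʳ-+ cs ds (proj₁ ∘ u)) (sym (+-cong (proj₁ (lincomb-components cs u)) (proj₁ (lincomb-components ds u)))))
    (trans (⊙-distribʳ-+ cs ds (proj₂ ∘ u)) (sym (+-cong (proj₂ (lincomb-components cs u)) (proj₂ (lincomb-components ds u)))))

  lincomb-scaleˡ : ∀ {n} a (cs : Fin n → Carrier) (u : Fin n → V) →
    lincomb (λ i → a * cs i) u ≈v (a ·v lincomb cs u)
  lincomb-scaleˡ a cs u = lincomb-≈ _ u
    (trans (⊙-scaleˡ a cs (proj₁ ∘ u)) (*-congˡ (sym (proj₁ (lincomb-components cs u)))))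
    (trans (⊙-scaleˡ a cs (proj₂ ∘ u)) (*-congˡ (sym (proj₂ (lincomb-components cs u)))))

  lincomb-scaleʳ : ∀ {n} a (cs : Fin n → Carrier) (u : Fin n → V) →
    lincomb cs (λ i → a ·v u i) ≈v (a ·v lincomb cs u)
  lincomb-scaleʳ a cs u = lincomb-≈ cs _
    (trans (⊙-scaleʳ a cs (proj₁ ∘ u)) (*-congˡ (sym (proj₁ (lincomb-components cs u)))))
    (trans (⊙-scaleʳ a cs (proj₂ ∘ u)) (*-congˡ (sym (proj₂ (lincomb-components cs u)))))

  lincomb-assoc : ∀ {a b} (d : Fin a → Carrier) (C : Fin a → Fin b → Carrier) {x : Fin a → V} (y : Fin b → V) →
    (∀ i → x i ≈v lincomb (C i) y) → lincomb d x ≈v lincomb (λ l → d ⊙ (λ i → C i l)) y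
  lincomb-assoc d C {x} y x≈ = lincomb-≈ d x (component proj₁ (proj₁ ∘ x≈) (λ cs u → proj₁ (lincomb-components cs u)))
                                         (component proj₂ (proj₂ ∘ x≈) (λ cs u → proj₂ (lincomb-components cs u)))
    where
    component : ∀ (π : V → Carrier) → (∀ i → π (x i) ≈ π (lincomb (C i) y)) →
      (∀ {n} (cs : Fin n → Carrier) (u : Fin n → V) → π (lincomb cs u) ≈ cs ⊙ (π ∘ u)) →
      d ⊙ (π ∘ x) ≈ π (lincomb (λ l → d ⊙ (λ i → C i l)) y)
    component π πx≈ π-lincomb = begin
      d ⊙ (π ∘ x)                              ≈⟨ ⊙-cong (λ _ → refl) (λ i → trans (πx≈ i) (π-lincomb (C i) y)) ⟩
      d ⊙ (λ i → C i ⊙ (π ∘ y))                ≈⟨ ⊙-assoc d C (π ∘ y) ⟩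
      (λ l → d ⊙ (λ i → C i l)) ⊙ (π ∘ y)      ≈⟨ π-lincomb _ y ⟨
      π (lincomb (λ l → d ⊙ (λ i → C i l)) y)  ∎

  Coefficients : ℕ → Set (c ⊔ p)
  Coefficients n = Σ (Fin n → Carrier) λ cs → ∀ i → inF (cs i)

  _≈c_ : ∀ {n} → Coefficients n → Coefficients n → Set ℓ
  (cs , _) ≈c (cs' , _) = ∀ i → cs i ≈ cs' i

  span-member : ∀ {n} (u : Fin n → V) j → InSpanF u (u j)
  span-member u j = δ j , inF-δ j , ≈v-sym (lincomb-≈ (δ j) u (δ⊙ j (proj₁ ∘ u)) (δ⊙ j (proj₂ ∘ u)))

  span-resp : ∀ {n} {u : Fin n → V} {z z'} → z ≈v z' → InSpanF u z → InSpanF u z'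
  span-resp z≈z' (cs , cs∈F , z≈) = cs , cs∈F , ≈v-trans (≈v-sym z≈z') z≈

  span-0 : ∀ {n} (u : Fin n → V) → InSpanF u 0v
  span-0 u = (λ _ → 0#) , (λ _ → has0) , ≈v-sym (lincomb-≈ _ u (⊙-zeroˡ (proj₁ ∘ u)) (⊙-zeroˡ (proj₂ ∘ u)))

  span-+ : ∀ {n} {u : Fin n → V} {z z'} → InSpanF u z → InSpanF u z' → InSpanF u (z +v z')
  span-+ {u = u} (cs , cs∈F , z≈) (cs' , cs'∈F , z'≈) =
    (λ i → cs i + cs' i) , (λ i → +-cl (cs∈F i) (cs'∈F i)) ,
    ≈v-trans (+-cong (proj₁ z≈) (proj₁ z'≈) , +-cong (proj₂ z≈) (proj₂ z'≈))
             (≈v-sym (lincomb-distribʳ-+ cs cs' u))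

  span-· : ∀ {n} {u : Fin n → V} {a z} → inF a → InSpanF u z → InSpanF u (a ·v z)
  span-· {u = u} {a} a∈F (cs , cs∈F , z≈) =
    (λ i → a * cs i) , (λ i → *-cl a∈F (cs∈F i)) ,
    ≈v-trans (*-congˡ (proj₁ z≈) , *-congˡ (proj₂ z≈)) (≈v-sym (lincomb-scaleˡ a cs u))

  span-neg : ∀ {n} {u : Fin n → V} {z} → InSpanF u z → InSpanF u ((- 1#) ·v z)
  span-neg = span-· (inF-neg has1)

  span-trans : ∀ {a b} {x : Fin a → V} {y : Fin b → V} → (∀ i → InSpanF y (x i)) →
    ∀ {z} → InSpanF x z → InSpanF y z
  span-trans {y = y} x∈ (d , d∈F , z≈) =
    (λ l → d ⊙ (λ i → C i l)) , (λ l → inF-⊙ d∈F (λ i → proj₁ (proj₂ (x∈ i)) l)) ,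
    ≈v-trans z≈ (lincomb-assoc d C y (λ i → proj₂ (proj₂ (x∈ i))))
    where
    C = λ i → proj₁ (x∈ i)

  indep-resp : ∀ {n} {u u' : Fin n → V} → (∀ i → u i ≈v u' i) → FIndep u → FIndep u'
  indep-resp u≈u' ind cs cs∈F lin≈0 = ind cs cs∈F (≈v-trans (lincomb-cong (λ _ → refl) u≈u') lin≈0)

  indep⇒nonzero : ∀ {n} {u : Fin n → V} → FIndep u → ∀ i → NonZero (u i)
  indep⇒nonzero {u = u} ind i uᵢ≈0 = 1≉0 (trans (sym (δ-diagonal i))
    (ind (δ i) (inF-δ i) (≈v-trans (≈v-sym (proj₂ (proj₂ (span-member u i)))) uᵢ≈0) i))

  indep⇒coefficients-unique : ∀ {n} {u : Fin n → V} → FIndep u → (cs cs' : Coefficients n) →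
    lincomb (proj₁ cs) u ≈v lincomb (proj₁ cs') u → cs ≈c cs'
  indep⇒coefficients-unique {n} {u} ind (cs , cs∈F) (cs' , cs'∈F) same i = begin
    cs i                  ≈⟨ solve 2 (λ c c' → c := c :- c' :+ c') refl (cs i) (cs' i) ⟩
    cs i - cs' i + cs' i  ≈⟨ +-congʳ (ind ds (λ j → +-cl (cs∈F j) (inF-neg (cs'∈F j))) lincomb-ds≈0 i) ⟩
    0# + cs' i            ≈⟨ +-identityˡ _ ⟩
    cs' i                 ∎
    where
    ds = λ j → cs j - cs' j
    component : ∀ (π : V → Carrier) → π (lincomb cs u) ≈ cs ⊙ (π ∘ u) → π (lincomb cs' u) ≈ cs' ⊙ (π ∘ u) →
      π (lincomb cs u) ≈ π (lincomb cs' u) → ds ⊙ (π ∘ u) ≈ 0#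
    component π π≈ π≈' same-π = begin
      ds ⊙ (π ∘ u)                          ≈⟨ ⊙-distribʳ-+ cs (λ j → - cs' j) (π ∘ u) ⟩
      cs ⊙ (π ∘ u) + (λ j → - cs' j) ⊙ (π ∘ u) ≈⟨ +-congˡ (⊙-negˡ cs' (π ∘ u)) ⟩
      cs ⊙ (π ∘ u) - cs' ⊙ (π ∘ u)          ≈⟨ x≈y⇒x∙y⁻¹≈ε (trans (sym π≈) (trans same-π π≈')) ⟩
      0#                                    ∎
    lincomb-ds≈0 : lincomb ds u ≈v 0v
    lincomb-ds≈0 = lincomb-≈ ds u
      (component proj₁ (proj₁ (lincomb-components cs u)) (proj₁ (lincomb-components cs' u)) (proj₁ same))
      (component proj₂ (proj₂ (lincomb-components cs u)) (proj₂ (lincomb-components cs' u)) (proj₂ same))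

  indep-∷ : ∀ {n} {y : Fin n → V} {z} → FIndep y → ¬ InSpanF y z → FIndep (z ∷ y)
  indep-∷ {y = y} {z} ind z∉ cs cs∈F lin≈0 with cs zero ≟ 0#
  ... | yes c₀≈0 = λ { zero → c₀≈0 ; (suc i) → ind (cs ∘ suc) (cs∈F ∘ suc) tail≈0 i }
    where
    drop-first : ∀ {x t} → cs zero * x + t ≈ 0# → t ≈ 0#
    drop-first lin≈ = trans (sym (+-identityˡ _)) (trans (+-congʳ (sym (trans (*-congʳ c₀≈0) (zeroˡ _)))) lin≈)
    tail≈0 : lincomb (cs ∘ suc) y ≈v 0v
    tail≈0 = drop-first (proj₁ lin≈0) , drop-first (proj₂ lin≈0)
  ... | no c₀≉0 = ⊥-elim (z∉ ((λ i → - c₀⁻¹ * cs (suc i)) , (λ i → *-cl (inF-neg c₀⁻¹∈F) (cs∈F (suc i))) ,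
      ≈v-trans (ax+y≈0⇒x≈-a⁻¹y c₀c₀⁻¹≈1 (proj₁ lin≈0) , ax+y≈0⇒x≈-a⁻¹y c₀c₀⁻¹≈1 (proj₂ lin≈0))
               (≈v-sym (lincomb-scaleˡ (- c₀⁻¹) (cs ∘ suc) y))))
    where
    c₀⁻¹ = proj₁ (inverse (cs zero) c₀≉0)
    c₀c₀⁻¹≈1 = proj₂ (inverse (cs zero) c₀≉0)
    c₀⁻¹∈F = inv-cl (cs∈F zero) c₀c₀⁻¹≈1

  indep-tail : ∀ {n} {y : Fin n → V} {z} → FIndep (z ∷ y) → FIndep y
  indep-tail ind cs cs∈F lin≈0 i = ind (0# ∷ cs) (λ { zero → has0 ; (suc j) → cs∈F j })
    (trans (+-congʳ (zeroˡ _)) (trans (+-identityˡ _) (proj₁ lin≈0)) ,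
     trans (+-congʳ (zeroˡ _)) (trans (+-identityˡ _) (proj₂ lin≈0))) (suc i)

  indep-head : ∀ {n} {y : Fin n → V} {z} → FIndep (z ∷ y) → ¬ InSpanF y z
  indep-head {z = z} ind (cs , cs∈F , z≈) = 1≉0 (begin
    1#        ≈⟨ -‿involutive 1# ⟨
    - - 1#    ≈⟨ -‿cong (ind ((- 1#) ∷ cs) (λ { zero → inF-neg has1 ; (suc j) → cs∈F j }) lin≈0 zero) ⟩
    - 0#      ≈⟨ -0#≈0# ⟩
    0#        ∎)
    where
    cancel : ∀ {x t} → x ≈ t → - 1# * x + t ≈ 0#
    cancel {x} {t} x≈t = trans (+-congˡ (sym x≈t)) (solve 1 (λ x → :- :1 :* x :+ x := :0) refl x)
    lin≈0 = cancel (proj₁ z≈) , cancel (proj₂ z≈)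

  indep-singleton : ∀ {w} → NonZero w → FIndep {1} (λ _ → w)
  indep-singleton w≢0 cs cs∈F lin≈0 zero with cs zero ≟ 0#
  ... | yes c≈0 = c≈0
  ... | no c≉0  = ⊥-elim (w≢0 (x≉0⇒xy≈0⇒y≈0 c≉0 (trans (sym (+-identityʳ _)) (proj₁ lin≈0)) ,
                               x≉0⇒xy≈0⇒y≈0 c≉0 (trans (sym (+-identityʳ _)) (proj₂ lin≈0))))

  coefficients-count : ∀ n → HasCount (Coefficients n) _≈c_ (q ^ n)
  coefficients-count zero = (λ _ → (λ ()) , (λ ())) , (λ { zero zero _ → ≡.refl }) , λ _ → zero , λ ()
  coefficients-count (suc n) = hasCount-map
    (hasCount-Σ {_≈A_ = _≈_ on proj₁} {_≈T_ = λ cs cs' → ∀ i → cs i ≈ cs' i}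
      (λ _ cs → ∀ i → inF (cs i)) F-count (λ _ → coefficients-count n) (λ _ cs∈F → cs∈F))
    (λ cs≈ cs'≈ i → trans (cs≈ i) (cs'≈ i))
    (λ { ((c , c∈F) , cs , cs∈F) → c ∷ cs , λ { zero → c∈F ; (suc i) → cs∈F i } })
    (λ { (c≈ , cs≈) → λ { zero → c≈ ; (suc i) → cs≈ i } })
    (λ _ _ ∷≈ → ∷≈ zero , ∷≈ ∘ suc)
    (λ (cs , cs∈F) → ((cs zero , cs∈F zero) , cs ∘ suc , cs∈F ∘ suc) , λ { zero → refl ; (suc i) → refl })
    where
    F-count : HasCount (Σ Carrier inF) (_≈_ on proj₁) q
    F-count = (λ i → enumF i , enumF-inF i) , enumF-injective , λ (x , x∈F) → enumF-surjective x x∈F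

  span? : ∀ {n} (u : Fin n → V) z → Dec (InSpanF u z)
  span? {n} u z = map′ (λ (k , z≈) → proj₁ (enum k) , proj₂ (enum k) , z≈) find
                       (Fin.any? (λ k → z ≟v lincomb (proj₁ (enum k)) u))
    where
    enum = proj₁ (coefficients-count n)
    find : InSpanF u z → ∃ λ k → z ≈v lincomb (proj₁ (enum k)) u
    find (cs , cs∈F , z≈) = let k , cs≈ = proj₂ (proj₂ (coefficients-count n)) (cs , cs∈F) in
                            k , ≈v-trans z≈ (lincomb-cong cs≈ (λ _ → ≈v-refl))

  ^-cancelʳ-≤ : ∀ {a b} → q ^ a ≤ q ^ b → a ≤ b
  ^-cancelʳ-≤ {a} {b} qᵃ≤qᵇ with a ℕ.≤? b
  ... | yes a≤b = a≤b
  ... | no  a≰b = ⊥-elim (ℕ.<⇒≱ (ℕ.^-monoʳ-< q 2≤q (ℕ.≰⇒> a≰b)) qᵃ≤qᵇ)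

  -- a ↦ lincomb a x is injective on F^a and lands in the span of y, which has at most q^b elements.
  indep-in-span⇒≤ : ∀ {a b} {x : Fin a → V} {y : Fin b → V} → FIndep x → (∀ i → InSpanF y (x i)) → a ≤ b
  indep-in-span⇒≤ {a} {b} {x} {y} ind x∈ = ^-cancelʳ-≤ (hasCount-≤ (coefficients-count a) (coefficients-count b)
    (λ ds≈ i → sym (ds≈ i)) (λ ds≈ ds≈' i → trans (ds≈ i) (ds≈' i)) coordinates reflects)
    where
    C = λ i → proj₁ (x∈ i)
    coordinates : Coefficients a → Coefficients b
    coordinates (d , d∈F) = (λ l → d ⊙ (λ i → C i l)) , (λ l → inF-⊙ d∈F (λ i → proj₁ (proj₂ (x∈ i)) l))
    lincomb-coordinates : ∀ d → lincomb (proj₁ d) x ≈v lincomb (proj₁ (coordinates d)) y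
    lincomb-coordinates (d , _) = lincomb-assoc d C y (λ i → proj₂ (proj₂ (x∈ i)))
    reflects : ∀ d d' → coordinates d ≈c coordinates d' → d ≈c d'
    reflects d d' coords≈ = indep⇒coefficients-unique ind d d' (≈v-trans (lincomb-coordinates d)
      (≈v-trans (lincomb-cong coords≈ (λ _ → ≈v-refl)) (≈v-sym (lincomb-coordinates d'))))

  indep-in-span⇒spans : ∀ {n} {w v : Fin n → V} → FIndep w → (∀ i → InSpanF v (w i)) → ∀ i → InSpanF w (v i)
  indep-in-span⇒spans {w = w} {v} w-indep w⊆v i with span? w (v i)
  ... | yes vᵢ∈ = vᵢ∈
  ... | no  vᵢ∉ = ⊥-elim (ℕ.<-irrefl ≡.refl (indep-in-span⇒≤ {x = v i ∷ w} {y = v} (indep-∷ {y = w} w-indep vᵢ∉)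
                    λ { zero → span-member v i ; (suc j) → w⊆v j }))

  InL-mono : ∀ {n n'} {u : Fin n → V} {u' : Fin n' → V} → (∀ i → InSpanF u (u' i)) → ∀ {w} → InL u' w → InL u w
  InL-mono u'⊆u (x , x-indep , x∈) = x , x-indep , λ i → span-trans u'⊆u (proj₁ (x∈ i)) , proj₂ (x∈ i)

  InL-intro : ∀ {n} {u : Fin n → V} {y} → NonZero y → InSpanF u y → InL u y
  InL-intro y≢0 y∈ = (λ _ → _) , indep-singleton y≢0 , λ _ → y∈ , 1# , sym (*-identityˡ _) , sym (*-identityˡ _)

  indep-scale : ∀ {n} {u : Fin n → V} {b} → ¬ (b ≈ 0#) → FIndep u → FIndep (λ i → b ·v u i)
  indep-scale {u = u} {b} b≉0 u-indep cs cs∈F lin≈0 = u-indep cs cs∈F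
    (x≉0⇒xy≈0⇒y≈0 b≉0 (trans (sym (proj₁ (lincomb-scaleʳ b cs u))) (proj₁ lin≈0)) ,
     x≉0⇒xy≈0⇒y≈0 b≉0 (trans (sym (proj₂ (lincomb-scaleʳ b cs u))) (proj₂ lin≈0)))

  InL-scale : ∀ {n} {u : Fin n → V} {b w} → ¬ (b ≈ 0#) → InL u w → InL (λ i → b ·v u i) w
  InL-scale {b = b} {w} b≉0 (x , x-indep , x∈) =
    (λ i → b ·v x i) , indep-scale {u = x} b≉0 x-indep , λ i → scaled-span (proj₁ (x∈ i)) , scaled-point (proj₂ (x∈ i))
    where
    scaled-span : ∀ {u : Fin _ → V} {z} → InSpanF u z → InSpanF (λ i → b ·v u i) (b ·v z)
    scaled-span {u} (cs , cs∈F , z≈) = cs , cs∈F ,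
      ≈v-trans (*-congˡ (proj₁ z≈) , *-congˡ (proj₂ z≈)) (≈v-sym (lincomb-scaleʳ b cs u))
    scaled-point : ∀ {z} → InPointK w z → InPointK w (b ·v z)
    scaled-point (a , z≈) = b * a , trans (*-congˡ (proj₁ z≈)) (sym (*-assoc _ _ _)) ,
                                    trans (*-congˡ (proj₂ z≈)) (sym (*-assoc _ _ _))

  InL-unscale : ∀ {n} {u : Fin n → V} {b w} → ¬ (b ≈ 0#) → InL (λ i → b ·v u i) w → InL u w
  InL-unscale {u = u} {b} b≉0 w∈ = InL-mono (λ i → span-resp (back (u i)) (span-member u i)) (InL-scale b⁻¹≉0 w∈)
    where
    b⁻¹ = proj₁ (inverse b b≉0)
    bb⁻¹≈1 = proj₂ (inverse b b≉0)
    b⁻¹≉0 = inverse-nonzero bb⁻¹≈1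
    back₁ : ∀ x → x ≈ b⁻¹ * (b * x)
    back₁ x = trans (sym (*-identityˡ x)) (trans (*-congʳ (trans (sym bb⁻¹≈1) (*-comm b b⁻¹))) (*-assoc _ _ _))
    back : ∀ z → z ≈v (b⁻¹ ·v (b ·v z))
    back (x , y) = back₁ x , back₁ y

module SpreadElement {c ℓ p} (K : Field c ℓ) (inF : Field.Carrier K → Set p)
  (isSubfield : Geometry.IsSubfield K inF)
  {q : ℕ} (F-size : Geometry.SubfieldSize K inF q)
  {t : ℕ} (K-size : Geometry.FieldSize K inF (q ^ t))
  (h : Geometry.V K inF) (h≢0 : Geometry.NonZero K inF h) where

  open SubfieldLinearAlgebra K inF isSubfield F-size K-size public

  ι : Carrier → V
  ι z = z ·v h

  ι-cong : ∀ {z z'} → z ≈ z' → ι z ≈v ι z'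
  ι-cong z≈z' = *-congʳ z≈z' , *-congʳ z≈z'

  ι-injective : ∀ {z z'} → ι z ≈v ι z' → z ≈ z'
  ι-injective {z} {z'} (≈₁ , ≈₂) with z - z' ≟ 0#
  ... | yes z-z'≈0 = x∙y⁻¹≈ε⇒x≈y z z' z-z'≈0
  ... | no  z-z'≉0 = ⊥-elim (h≢0 (x≉0⇒xy≈0⇒y≈0 z-z'≉0 (difference ≈₁) , x≉0⇒xy≈0⇒y≈0 z-z'≉0 (difference ≈₂)))
    where
    difference : ∀ {x} → z * x ≈ z' * x → (z - z') * x ≈ 0#
    difference {x} zx≈z'x = trans (solve 3 (λ z z' x → (z :- z') :* x := z :* x :- z' :* x) refl z z' x)
                                  (x≈y⇒x∙y⁻¹≈ε zx≈z'x)

  lincomb-ι : ∀ {n} (cs v : Fin n → Carrier) → lincomb cs (ι ∘ v) ≈v ι (cs ⊙ v)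
  lincomb-ι cs v = lincomb-≈ cs (ι ∘ v) (⊙-ι (proj₁ h)) (⊙-ι (proj₂ h))
    where
    ⊙-ι : ∀ x → cs ⊙ (λ i → v i * x) ≈ cs ⊙ v * x
    ⊙-ι x = trans (⊙-cong (λ _ → refl) (λ i → *-comm (v i) x)) (trans (⊙-scaleʳ x cs v) (*-comm x _))

  IndepK : ∀ {n} → (Fin n → Carrier) → Set _
  IndepK v = FIndep (ι ∘ v)

  InSpanK : ∀ {n} → (Fin n → Carrier) → Carrier → Set _
  InSpanK v z = InSpanF (ι ∘ v) (ι z)

  span-intro : ∀ {n} {v : Fin n → Carrier} {z} (cs : Coefficients n) → z ≈ proj₁ cs ⊙ v → InSpanK v z
  span-intro {v = v} (cs , cs∈F) z≈ = cs , cs∈F , ≈v-trans (ι-cong z≈) (≈v-sym (lincomb-ι cs v))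

  span-elim : ∀ {n} {v : Fin n → Carrier} {z} → InSpanK v z → ∃ λ (cs : Coefficients n) → z ≈ proj₁ cs ⊙ v
  span-elim {v = v} (cs , cs∈F , ιz≈) = (cs , cs∈F) , ι-injective (≈v-trans ιz≈ (lincomb-ι cs v))

  spanK-resp : ∀ {n} {v : Fin n → Carrier} {z z'} → z ≈ z' → InSpanK v z → InSpanK v z'
  spanK-resp = span-resp ∘ ι-cong

  spanK? : ∀ {n} (v : Fin n → Carrier) z → Dec (InSpanK v z)
  spanK? v z = span? (ι ∘ v) (ι z)

  spanK-member : ∀ {n} (v : Fin n → Carrier) i → InSpanK v (v i)
  spanK-member v = span-member (ι ∘ v)

  spanK-0 : ∀ {n} {v : Fin n → Carrier} {z} → z ≈ 0# → InSpanK v z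
  spanK-0 {v = v} z≈0 = span-resp (≈v-sym (trans (*-congʳ z≈0) (zeroˡ _) , trans (*-congʳ z≈0) (zeroˡ _))) (span-0 (ι ∘ v))

  spanK-+ : ∀ {n} {v : Fin n → Carrier} {a b} → InSpanK v a → InSpanK v b → InSpanK v (a + b)
  spanK-+ a∈ b∈ = span-resp (≈v-sym (distribʳ _ _ _ , distribʳ _ _ _)) (span-+ a∈ b∈)

  spanK-neg : ∀ {n} {v : Fin n → Carrier} {a} → InSpanK v a → InSpanK v (- a)
  spanK-neg {a = a} a∈ = span-resp (neg (proj₁ h) , neg (proj₂ h)) (span-neg a∈)
    where
    neg : ∀ x → - 1# * (a * x) ≈ - a * x
    neg = solve 2 (λ a x → :- :1 :* (a :* x) := :- a :* x) refl a

  spanK-trans : ∀ {a b} {v : Fin a → Carrier} {w : Fin b → Carrier} →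
    (∀ i → InSpanK v (w i)) → ∀ {z} → InSpanK w z → InSpanK v z
  spanK-trans w⊆v z∈ = span-trans w⊆v z∈

  indepK-∷ : ∀ {j} {v : Fin j → Carrier} {z} → IndepK v → ¬ InSpanK v z → IndepK (z ∷ v)
  indepK-∷ {v = v} {z} v-indep z∉ =
    indep-resp {u = ι z ∷ (ι ∘ v)} {u' = ι ∘ (z ∷ v)} (λ { zero → ≈v-refl ; (suc i) → ≈v-refl }) (indep-∷ v-indep z∉)

  indepK-uncons : ∀ {j} {w : Fin (suc j) → Carrier} → IndepK w → IndepK (w ∘ suc) × ¬ InSpanK (w ∘ suc) (w zero)
  indepK-uncons {w = w} w-indep = indep-tail w-indep' , indep-head w-indep'
    where
    w-indep' = indep-resp {u = ι ∘ w} {u' = ι (w zero) ∷ (ι ∘ w ∘ suc)} (λ { zero → ≈v-refl ; (suc i) → ≈v-refl }) w-indep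

  span-count : ∀ {j} (v : Fin j → Carrier) → IndepK v →
    HasCount (Σ Carrier (InSpanK v)) (_≈_ on proj₁) (q ^ j)
  span-count {j} v v-indep = hasCount-map (coefficients-count j) trans
    (λ cs → proj₁ cs ⊙ v , span-intro cs refl)
    (λ cs≈ → ⊙-cong cs≈ (λ _ → refl))
    (λ cs cs' ⊙≈ → indep⇒coefficients-unique v-indep cs cs'
      (≈v-trans (lincomb-ι _ v) (≈v-trans (ι-cong ⊙≈) (≈v-sym (lincomb-ι _ v)))))
    (λ (z , z∈) → span-elim z∈)

  coset-count : ∀ {j} (x₀ : Carrier) (v : Fin j → Carrier) → IndepK v →
    HasCount (Σ Carrier (λ z → InSpanK v (z - x₀))) (_≈_ on proj₁) (q ^ j)
  coset-count x₀ v v-indep = hasCount-map (span-count v v-indep) trans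
    (λ (z , z∈) → x₀ + z , spanK-resp (solve 2 (λ z x₀ → z := x₀ :+ z :- x₀) refl z x₀) z∈)
    +-congˡ
    (λ (z , _) (z' , _) x₀+z≈ → +-cancelˡ x₀ z z' x₀+z≈)
    (λ (z , z∈) → (z - x₀ , z∈) , solve 2 (λ z x₀ → z := x₀ :+ (z :- x₀)) refl z x₀)

  _≈t_ : ∀ {n} → (Fin n → Carrier) → (Fin n → Carrier) → Set ℓ
  v ≈t w = ∀ i → v i ≈ w i

  module IndependentTuples {ℓS} (S : Carrier → Set ℓS)
    (S-closed : ∀ {j} {v : Fin j → Carrier} → (∀ i → S (v i)) → ∀ {z} → InSpanK v z → S z)
    {n : ℕ} (S-count : HasCount (Σ Carrier S) (_≈_ on proj₁) (q ^ n)) where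

    IndepIn : ∀ {j} → (Fin j → Carrier) → Set _
    IndepIn v = IndepK v × (∀ i → S (v i))

    Tuple : ℕ → Set _
    Tuple j = Σ (Fin j → Carrier) IndepIn

    Extension : ∀ {j} → Tuple j → Carrier → Set _
    Extension (v , _) z = S z × ¬ InSpanK v z

    extensions-count : ∀ {j} (v : Tuple j) →
      HasCount (Σ Carrier (Extension v)) (_≈_ on proj₁) (q ^ n ℕ.∸ q ^ j)
    extensions-count {j} (v , v-indep , v∈S) = hasCount-map complement trans
      (λ ((z , z∈S) , z∉) → z , z∈S , z∉) (λ z≈ → z≈) (λ _ _ z≈ → z≈)
      (λ (z , z∈S , z∉) → ((z , z∈S) , z∉) , refl)
      where
      InSpan : Σ Carrier S → Set _
      InSpan = InSpanK v ∘ proj₁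
      span∩S-count : HasCount (Σ (Σ Carrier S) InSpan) ((_≈_ on proj₁) on proj₁) (q ^ j)
      span∩S-count = hasCount-map (span-count v v-indep) trans
        (λ (z , z∈) → (z , S-closed v∈S z∈) , z∈) (λ z≈ → z≈) (λ _ _ z≈ → z≈)
        (λ ((z , _) , z∈) → (z , z∈) , refl)
      complement = hasCount-complement InSpan (spanK? v ∘ proj₁) sym trans spanK-resp S-count span∩S-count

    tuples-count : ∀ j → HasCount (Tuple j) (_≈t_ on proj₁) (flags q n j)
    tuples-count zero = (λ _ → (λ ()) , (λ _ _ _ ()) , (λ ())) , (λ { zero zero _ → ≡.refl }) , (λ _ → zero , λ ())
    tuples-count (suc j) = ≡.subst (HasCount (Tuple (suc j)) (_≈t_ on proj₁)) (ℕ.*-comm (flags q n j) _)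
      (hasCount-map (hasCount-Σ {_≈A_ = _≈t_ on proj₁} {_≈T_ = _≈_} Extension (tuples-count j) extensions-count
                       (λ v≈ (z∈S , z∉) → z∈S , z∉ ∘ spanK-trans (λ i → spanK-resp (v≈ i) (spanK-member _ i))))
        (λ v≈ v≈' i → trans (v≈ i) (v≈' i))
        (λ ((v , v-indep , v∈S) , z , z∈S , z∉) →
           z ∷ v , indepK-∷ v-indep z∉ ,
           λ { zero → z∈S ; (suc i) → v∈S i })
        (λ (v≈ , z≈) → λ { zero → z≈ ; (suc i) → v≈ i })
        (λ _ _ ∷≈ → ∷≈ ∘ suc , ∷≈ zero)
        (λ (w , w-indep , w∈S) → let tail-indep , head∉ = indepK-uncons {w = w} w-indep in
           ((w ∘ suc , tail-indep , w∈S ∘ suc) , w zero , w∈S zero , head∉) ,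
           λ { zero → refl ; (suc i) → refl }))

  -- (x₀ , v) stands for the affine F-subspace x₀ + ⟨v⟩_F of K.
  module AffineSubspaces (m : ℕ) where

    private
      K-count : HasCount (Σ Carrier (λ _ → ⊤)) (_≈_ on proj₁) (q ^ t)
      K-count = hasCount-map K-size trans (λ x → x , tt) (λ x≈ → x≈) (λ _ _ x≈ → x≈) (λ (x , _) → x , refl)

    open IndependentTuples (λ _ → ⊤) (λ _ _ → tt) {t} K-count public
      using (IndepIn; Tuple; tuples-count)

    AffineBasis : Set _
    AffineBasis = Σ Carrier (λ _ → Tuple m)

    _≈a_ : AffineBasis → AffineBasis → Set ℓ
    _≈a_ = _≈Σ_ {_≈A_ = _≈_} {_≈T_ = _≈t_} (λ _ → IndepIn)

    SameSubspace : AffineBasis → AffineBasis → Set _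
    SameSubspace (x₀ , v , _) (x₀' , v' , _) = InSpanK v (x₀' - x₀) × (∀ i → InSpanK v (v' i))

    SameSubspace? : ∀ b b' → Dec (SameSubspace b b')
    SameSubspace? (x₀ , v , _) (x₀' , v' , _) with spanK? v (x₀' - x₀) | Fin.all? (λ i → spanK? v (v' i))
    ... | yes x₀'∈ | yes v'⊆ = yes (x₀'∈ , v'⊆)
    ... | no  x₀'∉ | _       = no (x₀'∉ ∘ proj₁)
    ... | _        | no  v'⊈ = no (v'⊈ ∘ proj₂)

    ≈a⇒SameSubspace : ∀ {b b'} → b ≈a b' → SameSubspace b b'
    ≈a⇒SameSubspace {x₀ , v , _} (x₀≈ , v≈) =
      spanK-0 (trans (+-congʳ (sym x₀≈)) (-‿inverseʳ x₀)) , λ i → spanK-resp (v≈ i) (spanK-member v i)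

    SameSubspace-sym : ∀ {b b'} → SameSubspace b b' → SameSubspace b' b
    SameSubspace-sym {x₀ , v , _} {x₀' , v' , v'-indep , _} (x₀'∈ , v'⊆) =
      spanK-resp (solve 2 (λ x₀ x₀' → :- (x₀' :- x₀) := x₀ :- x₀') refl x₀ x₀') (spanK-neg (spanK-trans v⊆ x₀'∈)) ,
      v⊆
      where v⊆ = indep-in-span⇒spans v'-indep v'⊆

    SameSubspace-trans : ∀ {b b' b''} → SameSubspace b b' → SameSubspace b' b'' → SameSubspace b b''
    SameSubspace-trans {x₀ , _} {x₀' , _} {x₀'' , _} (x₀'∈ , v'⊆) (x₀''∈ , v''⊆) =
      spanK-resp (solve 3 (λ x₀ x₀' x₀'' → (x₀'' :- x₀') :+ (x₀' :- x₀) := x₀'' :- x₀) refl x₀ x₀' x₀'')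
                 (spanK-+ (spanK-trans v'⊆ x₀''∈) x₀'∈) ,
      λ i → spanK-trans v'⊆ (v''⊆ i)

    affine-bases-count : HasCount AffineBasis _≈a_ (q ^ t ℕ.* flags q t m)
    affine-bases-count = hasCount-Σ {_≈A_ = _≈_} {_≈T_ = _≈t_} (λ _ → IndepIn) K-size (λ _ → tuples-count m) (λ _ v∈ → v∈)

    bases-of-subspace-count : ∀ b →
      HasCount (Σ AffineBasis (SameSubspace b)) (_≈a_ on proj₁) (q ^ m ℕ.* flags q m m)
    bases-of-subspace-count (x₀ , v , v-indep , _) = hasCount-map {_≈B_ = _≈a_ on proj₁}
      (hasCount-Σ {_≈A_ = _≈_ on proj₁} {_≈T_ = _≈t_} (λ _ → SpanTuples.IndepIn)
        (coset-count x₀ v v-indep) (λ _ → SpanTuples.tuples-count m) (λ _ v'∈ → v'∈))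
      (λ (x₀≈ , v≈) (x₀≈' , v≈') → trans x₀≈ x₀≈' , λ i → trans (v≈ i) (v≈' i))
      (λ ((x₀' , x₀'∈) , v' , v'-indep , v'⊆) → (x₀' , v' , v'-indep , (λ _ → tt)) , x₀'∈ , v'⊆)
      (λ b≈ → b≈) (λ _ _ b≈ → b≈)
      (λ ((x₀' , v' , v'-indep , _) , x₀'∈ , v'⊆) → ((x₀' , x₀'∈) , v' , v'-indep , v'⊆) , refl , λ _ → refl)
      where
      module SpanTuples = IndependentTuples (InSpanK v) spanK-trans {m} (span-count v v-indep)

    affine-subspaces-count : ∃ λ C → C ℕ.* (q ^ m ℕ.* flags q m m) ≡ q ^ t ℕ.* flags q t m ×
                                     HasCount AffineBasis SameSubspace C
    affine-subspaces-count = hasCount-quotient {_≈_ = _≈a_} (proj₂ (proj₂ affine-bases-count))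
                               (λ {b} {b'} → ≈a⇒SameSubspace {b} {b'}) class-size
      where
      open Quotient SameSubspace? (λ {b} {b'} → SameSubspace-sym {b} {b'})
        (λ {b} {b'} {b''} → SameSubspace-trans {b} {b'} {b''}) (proj₁ affine-bases-count)
        (q ^ m ℕ.* flags q m m) (q^m*flags>0 q 2≤q m ℕ.≤-refl)
      class-size : ∀ i → count (related i) ≡ q ^ m ℕ.* flags q m m
      class-size i = hasCount-unique {_≈_ = _≈a_ on proj₁}
        (hasCount-filter {_≈_ = _≈a_} (SameSubspace b) (SameSubspace? b)
          (λ {b'} {b''} b'≈ b~b' → SameSubspace-trans {b} {b'} {b''} b~b' (≈a⇒SameSubspace {b'} {b''} b'≈))
          affine-bases-count)
        (bases-of-subspace-count b)
        (λ (x₀≈ , v≈) → sym x₀≈ , λ j → sym (v≈ j))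
        (λ (x₀≈ , v≈) (x₀≈' , v≈') → trans x₀≈ x₀≈' , λ j → trans (v≈ j) (v≈' j))
        where b = proj₁ affine-bases-count i

module ClubsWithHead {c ℓ p} (K : Field c ℓ) (inF : Field.Carrier K → Set p)
  (isSubfield : Geometry.IsSubfield K inF)
  {q : ℕ} (F-size : Geometry.SubfieldSize K inF q)
  {t : ℕ} (K-size : Geometry.FieldSize K inF (q ^ t))
  (h : Geometry.V K inF) (h≢0 : Geometry.NonZero K inF h) where

  open SpreadElement K inF isSubfield F-size {t} K-size h h≢0 public

  form : Carrier → Carrier → V → Carrier
  form k k' (x , y) = x * k + y * k'

  module _ (k k' : Carrier) where

    form-cong : ∀ {u w} → u ≈v w → form k k' u ≈ form k k' w
    form-cong (x≈ , y≈) = +-cong (*-congʳ x≈) (*-congʳ y≈)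

    form-+ : ∀ u w → form k k' (u +v w) ≈ form k k' u + form k k' w
    form-+ (x , y) (x' , y') =
      solve 6 (λ x y x' y' k k' → (x :+ x') :* k :+ (y :+ y') :* k' := (x :* k :+ y :* k') :+ (x' :* k :+ y' :* k'))
        refl x y x' y' k k'

    form-· : ∀ a u → form k k' (a ·v u) ≈ a * form k k' u
    form-· a (x , y) = solve 5 (λ a x y k k' → a :* x :* k :+ a :* y :* k' := a :* (x :* k :+ y :* k')) refl a x y k k'

    form-lincomb : ∀ {n} (cs : Fin n → Carrier) (u : Fin n → V) → form k k' (lincomb cs u) ≈ cs ⊙ (form k k' ∘ u)
    form-lincomb {zero}  cs u = trans (+-cong (zeroˡ k) (zeroˡ k')) (+-identityʳ 0#)
    form-lincomb {suc n} cs u = trans (form-+ _ _) (+-cong (form-· (cs zero) (u zero)) (form-lincomb (cs ∘ suc) (u ∘ suc)))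

  det : V → V → Carrier
  det (a , b) (c , d) = a * d - b * c

  complement-of-h : ∃ λ e → ¬ (det e h ≈ 0#)
  complement-of-h with proj₂ h ≟ 0#
  ... | no h₂≉0 = (1# , 0#) , h₂≉0 ∘ trans (sym (solve 2 (λ h₁ h₂ → :1 :* h₂ :- :0 :* h₁ := h₂) refl (proj₁ h) (proj₂ h)))
  ... | yes h₂≈0 = (0# , - 1#) , λ Δ≈0 → h≢0 (trans (sym (solve 2 (λ h₁ h₂ → :0 :* h₂ :- (:- :1) :* h₁ := h₁) refl (proj₁ h) (proj₂ h))) Δ≈0 , h₂≈0)

  e : V
  e = proj₁ complement-of-h

  private
    e₁ = proj₁ e
    e₂ = proj₂ e
    h₁ = proj₁ h
    h₂ = proj₂ h
    Δ⁻¹ = proj₁ (inverse (det e h) (proj₂ complement-of-h))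
    ΔΔ⁻¹≈1 : (e₁ * h₂ - e₂ * h₁) * Δ⁻¹ ≈ 1#
    ΔΔ⁻¹≈1 = proj₂ (inverse (det e h) (proj₂ complement-of-h))

  -- (α v , β v) are the coordinates of v in the K-basis (e , h), by Cramer's rule.
  α β : V → Carrier
  α = form (h₂ * Δ⁻¹) (- h₁ * Δ⁻¹)
  β = form (- e₂ * Δ⁻¹) (e₁ * Δ⁻¹)

  coordinates : ∀ v → v ≈v ((α v ·v e) +v (β v ·v h))
  coordinates (x , y) =
    trans (rescale x) (solve 7 (λ x y e₁ e₂ h₁ h₂ d →
      x :* ((e₁ :* h₂ :- e₂ :* h₁) :* d) := (x :* (h₂ :* d) :+ y :* (:- h₁ :* d)) :* e₁ :+ (x :* (:- e₂ :* d) :+ y :* (e₁ :* d)) :* h₁)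
      refl x y e₁ e₂ h₁ h₂ Δ⁻¹) ,
    trans (rescale y) (solve 7 (λ x y e₁ e₂ h₁ h₂ d →
      y :* ((e₁ :* h₂ :- e₂ :* h₁) :* d) := (x :* (h₂ :* d) :+ y :* (:- h₁ :* d)) :* e₂ :+ (x :* (:- e₂ :* d) :+ y :* (e₁ :* d)) :* h₂)
      refl x y e₁ e₂ h₁ h₂ Δ⁻¹)
    where
    rescale : ∀ z → z ≈ z * ((e₁ * h₂ - e₂ * h₁) * Δ⁻¹)
    rescale z = trans (sym (*-identityʳ z)) (*-congˡ (sym ΔΔ⁻¹≈1))

  α-e : α e ≈ 1#
  α-e = trans (solve 5 (λ e₁ e₂ h₁ h₂ d → e₁ :* (h₂ :* d) :+ e₂ :* (:- h₁ :* d) := (e₁ :* h₂ :- e₂ :* h₁) :* d)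
                 refl e₁ e₂ h₁ h₂ Δ⁻¹) ΔΔ⁻¹≈1

  β-e : β e ≈ 0#
  β-e = solve 3 (λ e₁ e₂ d → e₁ :* (:- e₂ :* d) :+ e₂ :* (e₁ :* d) := :0) refl e₁ e₂ Δ⁻¹

  α-h : α h ≈ 0#
  α-h = solve 3 (λ h₁ h₂ d → h₁ :* (h₂ :* d) :+ h₂ :* (:- h₁ :* d) := :0) refl h₁ h₂ Δ⁻¹

  β-h : β h ≈ 1#
  β-h = trans (solve 5 (λ e₁ e₂ h₁ h₂ d → h₁ :* (:- e₂ :* d) :+ h₂ :* (e₁ :* d) := (e₁ :* h₂ :- e₂ :* h₁) :* d)
                 refl e₁ e₂ h₁ h₂ Δ⁻¹) ΔΔ⁻¹≈1

  α-cong : ∀ {u w} → u ≈v w → α u ≈ α w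
  α-cong = form-cong _ _

  β-cong : ∀ {u w} → u ≈v w → β u ≈ β w
  β-cong = form-cong _ _

  α-· : ∀ a u → α (a ·v u) ≈ a * α u
  α-· = form-· _ _

  β-· : ∀ a u → β (a ·v u) ≈ a * β u
  β-· = form-· _ _

  α-ι : ∀ z → α (ι z) ≈ 0#
  α-ι z = trans (α-· z h) (trans (*-congˡ α-h) (zeroʳ z))

  β-ι : ∀ z → β (ι z) ≈ z
  β-ι z = trans (β-· z h) (trans (*-congˡ β-h) (*-identityʳ z))

  coordinates-injective : ∀ {u w} → α u ≈ α w → β u ≈ β w → u ≈v w
  coordinates-injective {u} {w} α≈ β≈ = ≈v-trans (coordinates u) (≈v-trans
    (+-cong (*-congʳ α≈) (*-congʳ β≈) , +-cong (*-congʳ α≈) (*-congʳ β≈)) (≈v-sym (coordinates w)))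

  α≈0⇒InPoint-h : ∀ {w} → α w ≈ 0# → InPointK h w
  α≈0⇒InPoint-h {w} αw≈0 = β w , ≈v-trans (coordinates w) (drop-e (proj₁ e) , drop-e (proj₂ e))
    where
    drop-e : ∀ {y} x → α w * x + y ≈ y
    drop-e x = trans (+-congʳ (trans (*-congʳ αw≈0) (zeroˡ x))) (+-identityˡ _)

  InPoint-h⇒α≈0 : ∀ {w} → InPointK h w → α w ≈ 0#
  InPoint-h⇒α≈0 (a , w≈) = trans (α-cong w≈) (α-ι a)

  α-span : ∀ {n} {u : Fin n → V} {z} → (∀ i → α (u i) ≈ 0#) → InSpanF u z → α z ≈ 0#
  α-span {u = u} αu≈0 (cs , _ , z≈) = trans (α-cong z≈) (trans (form-lincomb _ _ cs u)
    (trans (⊙-cong (λ _ → refl) αu≈0) (⊙-zeroʳ cs)))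

  α-e+ι : ∀ x₀ → α (e +v ι x₀) ≈ 1#
  α-e+ι x₀ = trans (form-+ _ _ e (ι x₀)) (trans (+-cong α-e (α-ι x₀)) (+-identityʳ 1#))

  β-e+ι : ∀ x₀ → β (e +v ι x₀) ≈ x₀
  β-e+ι x₀ = trans (form-+ _ _ e (ι x₀)) (trans (+-cong β-e (β-ι x₀)) (+-identityˡ x₀))

  module _ (m : ℕ) where

    open AffineSubspaces m

    club : AffineBasis → Fin (suc m) → V
    club (x₀ , v , _) = (e +v ι x₀) ∷ (ι ∘ v)

    α-club : ∀ b (cs : Fin (suc m) → Carrier) → α (lincomb cs (club b)) ≈ cs zero
    α-club b@(x₀ , v , _) cs = begin
      α (lincomb cs (club b))                               ≈⟨ form-lincomb _ _ cs (club b) ⟩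
      cs zero * α (e +v ι x₀) + (cs ∘ suc) ⊙ (α ∘ ι ∘ v)    ≈⟨ +-cong (*-congˡ (α-e+ι x₀)) (⊙-cong (λ _ → refl) (α-ι ∘ v)) ⟩
      cs zero * 1# + (cs ∘ suc) ⊙ (λ _ → 0#)                ≈⟨ +-cong (*-identityʳ _) (⊙-zeroʳ (cs ∘ suc)) ⟩
      cs zero + 0#                                          ≈⟨ +-identityʳ _ ⟩
      cs zero                                               ∎

    β-club : ∀ b (cs : Fin (suc m) → Carrier) → β (lincomb cs (club b)) ≈ cs zero * proj₁ b + (cs ∘ suc) ⊙ proj₁ (proj₂ b)
    β-club b@(x₀ , v , _) cs = trans (form-lincomb _ _ cs (club b))
      (+-cong (*-congˡ (β-e+ι x₀)) (⊙-cong (λ _ → refl) (β-ι ∘ v)))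

    span-club⇒α∈F : ∀ b {z} → InSpanF (club b) z → inF (α z)
    span-club⇒α∈F b (cs , cs∈F , z≈) = resp (sym (trans (α-cong z≈) (α-club b cs))) (cs∈F zero)

    span-club∩ker-α : ∀ b {z} → InSpanF (club b) z → α z ≈ 0# → InSpanF (ι ∘ proj₁ (proj₂ b)) z
    span-club∩ker-α b (cs , cs∈F , z≈) αz≈0 = cs ∘ suc , cs∈F ∘ suc , ≈v-trans z≈ (drop-head , drop-head)
      where
      c₀≈0 : cs zero ≈ 0#
      c₀≈0 = trans (sym (α-club b cs)) (trans (sym (α-cong z≈)) αz≈0)
      drop-head : ∀ {x y} → cs zero * x + y ≈ y
      drop-head = trans (+-congʳ (trans (*-congʳ c₀≈0) (zeroˡ _))) (+-identityˡ _)

    club-indep : ∀ b → FIndep (club b)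
    club-indep (x₀ , v , v-indep , _) = indep-∷ v-indep (λ head∈ → 1≉0 (trans (sym (α-e+ι x₀)) (α-span (α-ι ∘ v) head∈)))

    club-head-weight : ∀ b → WeightEq (club b) h m
    club-head-weight b@(x₀ , v , v-indep , _) =
      (ι ∘ v , v-indep , λ i → span-member (club b) (suc i) , v i , ≈v-refl) ,
      λ (x , x-indep , x∈) → ℕ.<-irrefl ≡.refl
        (indep-in-span⇒≤ x-indep (λ i → span-club∩ker-α b (proj₁ (x∈ i)) (InPoint-h⇒α≈0 (proj₂ (x∈ i)))))

    -- If x₀, x₁ ∈ ⟨w⟩_K lie in the span, α x₁ · x₀ − α x₀ · x₁ = 0 is an F-relation, as α is F-valued there.
    club-other-weight : ∀ b w → NonZero w → ¬ InPointK h w → InL (club b) w → WeightEq (club b) w 1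
    club-other-weight b w w≢0 w∉h w∈L = w∈L , λ (x , x-indep , x∈) → indep⇒nonzero {u = x} x-indep (suc zero) (x₁≈0 x x-indep x∈)
      where
      αw≉0 : ¬ (α w ≈ 0#)
      αw≉0 = w∉h ∘ α≈0⇒InPoint-h
      x₁≈0 : (x : Fin 2 → V) → FIndep x → (∀ i → InSpanF (club b) (x i) × InPointK w (x i)) → x (suc zero) ≈v 0v
      x₁≈0 x x-indep x∈ = ≈v-trans x₁≈ (trans (*-congʳ a₁≈0) (zeroˡ _) , trans (*-congʳ a₁≈0) (zeroˡ _))
        where
        a₀ = proj₁ (proj₂ (x∈ zero))
        a₁ = proj₁ (proj₂ (x∈ (suc zero)))
        x₀≈ = proj₂ (proj₂ (x∈ zero))
        x₁≈ = proj₂ (proj₂ (x∈ (suc zero)))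
        αx₀≈ : α (x zero) ≈ a₀ * α w
        αx₀≈ = trans (α-cong x₀≈) (α-· a₀ w)
        αx₁≈ : α (x (suc zero)) ≈ a₁ * α w
        αx₁≈ = trans (α-cong x₁≈) (α-· a₁ w)
        cs : Fin 2 → Carrier
        cs = α (x (suc zero)) ∷ (- α (x zero) ∷ λ _ → 0#)
        cs∈F : ∀ i → inF (cs i)
        cs∈F zero          = span-club⇒α∈F b (proj₁ (x∈ (suc zero)))
        cs∈F (suc zero)    = inF-neg (span-club⇒α∈F b (proj₁ (x∈ zero)))
        cancel : ∀ {y₀ y₁ z} → y₀ ≈ a₀ * z → y₁ ≈ a₁ * z → α (x (suc zero)) * y₀ + (- α (x zero) * y₁ + 0#) ≈ 0#
        cancel {y₀} {y₁} {z} y₀≈ y₁≈ = trans (+-cong (*-cong αx₁≈ y₀≈) (+-congʳ (*-cong (-‿cong αx₀≈) y₁≈)))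
          (solve 4 (λ a₀ a₁ αw z → a₁ :* αw :* (a₀ :* z) :+ (:- (a₀ :* αw) :* (a₁ :* z) :+ :0) := :0) refl a₀ a₁ (α w) z)
        αx₁≈0 : α (x (suc zero)) ≈ 0#
        αx₁≈0 = x-indep cs cs∈F (cancel (proj₁ x₀≈) (proj₁ x₁≈) , cancel (proj₂ x₀≈) (proj₂ x₁≈)) zero
        a₁≈0 : a₁ ≈ 0#
        a₁≈0 = x≉0⇒xy≈0⇒y≈0 αw≉0 (trans (*-comm _ _) (trans (sym αx₁≈) αx₁≈0))

    club-of : AffineBasis → ClubWithHead (suc m) h
    club-of b = club b , club-indep b , club-head-weight b , club-other-weight b

    SameSubspace⇒span⊆ : ∀ b b' → SameSubspace b b' → ∀ i → InSpanF (club b) (club b' i)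
    SameSubspace⇒span⊆ b@(x₀ , v , _) (x₀' , v' , _) (x₀'-x₀∈ , v'⊆) zero =
      span-resp {u = club b} (≈v-sym (shift (proj₁ e) (proj₁ h) , shift (proj₂ e) (proj₂ h)))
        (span-+ {u = club b} (span-member (club b) zero) (span-trans {y = club b} v⊆club x₀'-x₀∈))
      where
      v⊆club : ∀ i → InSpanF (club b) (ι (v i))
      v⊆club i = span-member (club b) (suc i)
      shift : ∀ e₁ h₁ → e₁ + x₀' * h₁ ≈ (e₁ + x₀ * h₁) + (x₀' - x₀) * h₁
      shift = solve 4 (λ x₀ x₀' e₁ h₁ → e₁ :+ x₀' :* h₁ := (e₁ :+ x₀ :* h₁) :+ (x₀' :- x₀) :* h₁) refl x₀ x₀'
    SameSubspace⇒span⊆ b (x₀' , v' , _) (_ , v'⊆) (suc i) =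
      span-trans {y = club b} (λ j → span-member (club b) (suc j)) (v'⊆ i)

    SameSubspace⇒SameLinearSet : ∀ b b' → SameSubspace b b' → SameLinearSet (club-of b) (club-of b')
    SameSubspace⇒SameLinearSet b b' b~b' w _ =
      InL-mono {u = club b'} {u' = club b} (SameSubspace⇒span⊆ b' b (SameSubspace-sym {b} {b'} b~b')) ,
      InL-mono {u = club b} {u' = club b'} (SameSubspace⇒span⊆ b b' b~b')

    -- The multiple a·y of y in the span has a = α (a·y) ∈ F, so β y = a⁻¹ β (a·y) ∈ x₀ + ⟨v⟩_F.
    InL-club⇒β∈subspace : ∀ b {y} → InL (club b) y → α y ≈ 1# → InSpanK (proj₁ (proj₂ b)) (β y - proj₁ b)
    InL-club⇒β∈subspace b@(x₀ , v , _) {y} (x , x-indep , x∈) αy≈1 =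
      span-intro ((λ i → a⁻¹ * cs (suc i)) , (λ i → *-cl a⁻¹∈F (cs∈F (suc i))))
        (trans β-chain (sym (⊙-scaleˡ a⁻¹ (cs ∘ suc) v)))
      where
      a = proj₁ (proj₂ (x∈ zero))
      x≈ay = proj₂ (proj₂ (x∈ zero))
      cs = proj₁ (proj₁ (x∈ zero))
      cs∈F = proj₁ (proj₂ (proj₁ (x∈ zero)))
      x≈lincomb = proj₂ (proj₂ (proj₁ (x∈ zero)))
      a≈c₀ : a ≈ cs zero
      a≈c₀ = trans (sym (trans (α-cong x≈ay) (trans (α-· a y) (trans (*-congˡ αy≈1) (*-identityʳ a)))))
                   (trans (α-cong x≈lincomb) (α-club b cs))
      a≉0 : ¬ (a ≈ 0#)
      a≉0 a≈0 = indep⇒nonzero {u = x} x-indep zero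
        (≈v-trans x≈ay (trans (*-congʳ a≈0) (zeroˡ _) , trans (*-congʳ a≈0) (zeroˡ _)))
      a⁻¹ = proj₁ (inverse a a≉0)
      aa⁻¹≈1 = proj₂ (inverse a a≉0)
      a⁻¹∈F : inF a⁻¹
      a⁻¹∈F = inv-cl (resp (sym a≈c₀) (cs∈F zero)) aa⁻¹≈1
      L = (cs ∘ suc) ⊙ v
      aβy≈ : a * β y ≈ cs zero * x₀ + L
      aβy≈ = trans (sym (β-· a y)) (trans (sym (β-cong x≈ay)) (trans (β-cong x≈lincomb) (β-club b cs)))
      β-chain : β y - x₀ ≈ a⁻¹ * L
      β-chain = begin
        β y - x₀                          ≈⟨ +-cong (*-identityˡ _) (-‿cong (*-identityˡ _)) ⟨
        1# * β y - 1# * x₀                ≈⟨ +-cong (*-congʳ aa⁻¹≈1) (-‿cong (*-congʳ aa⁻¹≈1)) ⟨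
        a * a⁻¹ * β y - a * a⁻¹ * x₀      ≈⟨ solve 4 (λ a a⁻¹ b x → a :* a⁻¹ :* b :- a :* a⁻¹ :* x := a⁻¹ :* (a :* b) :- a⁻¹ :* (a :* x)) refl a a⁻¹ (β y) x₀ ⟩
        a⁻¹ * (a * β y) - a⁻¹ * (a * x₀)  ≈⟨ +-cong (*-congˡ aβy≈) (-‿cong (*-congˡ (*-congʳ a≈c₀))) ⟩
        a⁻¹ * (cs zero * x₀ + L) - a⁻¹ * (cs zero * x₀) ≈⟨ solve 4 (λ a⁻¹ c x L → a⁻¹ :* (c :* x :+ L) :- a⁻¹ :* (c :* x) := a⁻¹ :* L) refl a⁻¹ (cs zero) x₀ L ⟩
        a⁻¹ * L                           ∎

    SameLinearSet⇒SameSubspace : ∀ b b' → SameLinearSet (club-of b) (club-of b') → SameSubspace b b'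
    SameLinearSet⇒SameSubspace b@(x₀ , v , _) b'@(x₀' , v' , _) same = x₀'-x₀∈ , v'⊆
      where
      β∈subspace : ∀ {y} → InSpanF (club b') y → α y ≈ 1# → InSpanK v (β y - x₀)
      β∈subspace {y} y∈ αy≈1 = InL-club⇒β∈subspace b (proj₂ (same y y≢0) (InL-intro {u = club b'} y≢0 y∈)) αy≈1
        where
        y≢0 : NonZero y
        y≢0 y≈0 = 1≉0 (trans (sym αy≈1) (trans (α-cong y≈0) (trans (+-cong (zeroˡ _) (zeroˡ _)) (+-identityʳ 0#))))
      x₀'-x₀∈ : InSpanK v (x₀' - x₀)
      x₀'-x₀∈ = spanK-resp (+-congʳ (β-e+ι x₀')) (β∈subspace (span-member (club b') zero) (α-e+ι x₀'))
      v'⊆ : ∀ i → InSpanK v (v' i)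
      v'⊆ i = spanK-resp (solve 3 (λ x₀ x₀' w → (x₀' :+ w :- x₀) :+ :- (x₀' :- x₀) := w) refl x₀ x₀' (v' i))
                (spanK-+ (spanK-resp (+-congʳ βyᵢ≈) yᵢ∈) (spanK-neg x₀'-x₀∈))
        where
        yᵢ = (e +v ι x₀') +v ι (v' i)
        αyᵢ≈1 : α yᵢ ≈ 1#
        αyᵢ≈1 = trans (form-+ _ _ _ _) (trans (+-cong (α-e+ι x₀') (α-ι (v' i))) (+-identityʳ 1#))
        βyᵢ≈ : β yᵢ ≈ x₀' + v' i
        βyᵢ≈ = trans (form-+ _ _ _ _) (+-cong (β-e+ι x₀') (β-ι (v' i)))
        yᵢ∈ : InSpanK v (β yᵢ - x₀)
        yᵢ∈ = β∈subspace (span-+ {u = club b'} (span-member (club b') zero) (span-member (club b') (suc i))) αyᵢ≈1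

    off-head : ∀ (cl : ClubWithHead (suc m) h) → ∃ λ j → ¬ (α (proj₁ cl j) ≈ 0#)
    off-head (u , u-indep , (_ , ¬weight>m) , _) with Fin.any? (λ j → ¬? (α (u j) ≟ 0#))
    ... | yes off = off
    ... | no  none = ⊥-elim (¬weight>m (u , u-indep , λ j → span-member u j , α≈0⇒InPoint-h (αu≈0 j)))
      where
      αu≈0 : ∀ j → α (u j) ≈ 0#
      αu≈0 j = decidable-stable (α (u j) ≟ 0#) (λ αuⱼ≉0 → none (j , αuⱼ≉0))

    normalised-club : ∀ {y a⁻¹} {x : Fin m → V} → α y * a⁻¹ ≈ 1# → FIndep x → (∀ i → InPointK h (x i)) →
      Σ AffineBasis λ b → ∀ i → club b i ≈v (a⁻¹ ·v (y ∷ x) i)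
    normalised-club {y} {a⁻¹} {x} αya⁻¹≈1 x-indep x∈h = (a⁻¹ * β y , v , v-indep , _) , club≈
      where
      v : Fin m → Carrier
      v i = a⁻¹ * proj₁ (x∈h i)
      ιv≈ : ∀ i → (a⁻¹ ·v x i) ≈v ι (v i)
      ιv≈ i = trans (*-congˡ (proj₁ (proj₂ (x∈h i)))) (sym (*-assoc _ _ _)) ,
              trans (*-congˡ (proj₂ (proj₂ (x∈h i)))) (sym (*-assoc _ _ _))
      v-indep : IndepK v
      v-indep = indep-resp ιv≈ (indep-scale (inverse-nonzero αya⁻¹≈1) x-indep)
      club≈ : ∀ i → club (a⁻¹ * β y , v , v-indep , _) i ≈v (a⁻¹ ·v (y ∷ x) i)
      club≈ zero    = coordinates-injective (trans (α-e+ι _) (sym (trans (α-· a⁻¹ y) (trans (*-comm a⁻¹ _) αya⁻¹≈1))))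
                                            (trans (β-e+ι _) (sym (β-· a⁻¹ y)))
      club≈ (suc i) = ≈v-sym (ιv≈ i)

    -- u spans the same F-space as y ∷ x (y off the head, x an F-basis of the part in the head),
    -- and (α y)⁻¹ · (y ∷ x) is the basis of a club of an affine basis.
    club-surjective : ∀ (cl : ClubWithHead (suc m) h) → ∃ λ b → SameLinearSet cl (club-of b)
    club-surjective cl@(u , _ , ((x , x-indep , x∈) , _) , _) = b , λ _ _ → to-club , from-club
      where
      j = proj₁ (off-head cl)
      y = u j
      a⁻¹ = proj₁ (inverse (α y) (proj₂ (off-head cl)))
      αya⁻¹≈1 = proj₂ (inverse (α y) (proj₂ (off-head cl)))
      b = proj₁ (normalised-club αya⁻¹≈1 x-indep (proj₂ ∘ x∈))
      club≈ = proj₂ (normalised-club αya⁻¹≈1 x-indep (proj₂ ∘ x∈))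
      Y : Fin (suc m) → V
      Y = y ∷ x
      Y⊆u : ∀ i → InSpanF u (Y i)
      Y⊆u zero    = span-member u j
      Y⊆u (suc i) = proj₁ (x∈ i)
      u⊆Y : ∀ l → InSpanF Y (u l)
      u⊆Y = indep-in-span⇒spans
        (indep-∷ {y = x} x-indep (proj₂ (off-head cl) ∘ α-span (λ i → InPoint-h⇒α≈0 (proj₂ (x∈ i))))) Y⊆u
      club⊆ : ∀ i → InSpanF (club b) (a⁻¹ ·v Y i)
      club⊆ i = span-resp {u = club b} (club≈ i) (span-member (club b) i)
      ⊆club : ∀ i → InSpanF (λ i → a⁻¹ ·v Y i) (club b i)
      ⊆club i = span-resp {u = λ i → a⁻¹ ·v Y i} (≈v-sym (club≈ i)) (span-member (λ i → a⁻¹ ·v Y i) i)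
      a⁻¹≉0 = inverse-nonzero αya⁻¹≈1
      to-club : ∀ {w} → InL u w → InL (club b) w
      to-club w∈ = InL-mono {u = club b} club⊆ (InL-scale {u = Y} a⁻¹≉0 (InL-mono {u = Y} u⊆Y w∈))
      from-club : ∀ {w} → InL (club b) w → InL u w
      from-club w∈ = InL-mono {u = u} Y⊆u (InL-unscale {u = Y} a⁻¹≉0 (InL-mono {u = λ i → a⁻¹ ·v Y i} ⊆club w∈))

    clubs-count : ∃ λ C → C ℕ.* (q ^ m ℕ.* flags q m m) ≡ q ^ t ℕ.* flags q t m ×
                          HasCount (ClubWithHead (suc m) h) SameLinearSet C
    clubs-count =
      let C , C*M≡N , subspaces = affine-subspaces-count in
      C , C*M≡N , hasCount-map {_≈B_ = SameLinearSet} subspaces (λ {x} {y} {z} → SameLinearSet-trans {x} {y} {z}) club-of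
                    (λ {b} {b'} → SameSubspace⇒SameLinearSet b b') SameLinearSet⇒SameSubspace club-surjective
      where
      SameLinearSet-trans : ∀ {x y z : ClubWithHead (suc m) h} → SameLinearSet x y → SameLinearSet y z → SameLinearSet x z
      SameLinearSet-trans x~y y~z w w≢0 = proj₁ (y~z w w≢0) ∘ proj₁ (x~y w w≢0) , proj₂ (x~y w w≢0) ∘ proj₂ (y~z w w≢0)

open import Data.Nat using (ℕ; suc; _≤_; _∸_; _^_; _*_)

proposition3p4 : ∀ {c ℓ p} (K : Field c ℓ) (inF : Field.Carrier K → Set p)
    (q t k : ℕ) →
    Geometry.IsSubfield K inF →
    Geometry.SubfieldSize K inF q →
    Geometry.FieldSize K inF (q ^ t) →
    1 ≤ k → k ≤ suc t →
    (P∞ : Geometry.V K inF) → Geometry.NonZero K inF P∞ →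
    HasCount (Geometry.ClubWithHead K inF k P∞) (Geometry.SameLinearSet K inF)
      (q ^ (suc t ∸ k) * gauss q t (k ∸ 1))
proposition3p4 K inF q t (suc m) isSubfield F-size K-size _ (s≤s m≤t) P∞ P∞≢0 =
  ≡.subst (HasCount (Geometry.ClubWithHead K inF (suc m) P∞) (Geometry.SameLinearSet K inF))
    (quotient≡q^[t∸m]*gauss q 2≤q t m C m≤t C*M≡N) clubs
  where
  open ClubsWithHead K inF isSubfield F-size {t} K-size P∞ P∞≢0 using (clubs-count; 2≤q)
  C = proj₁ (clubs-count m)
  C*M≡N = proj₁ (proj₂ (clubs-count m))
  clubs = proj₂ (proj₂ (clubs-count m))
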